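{- Let $s=(s_1,\dots,s_n)$ be a weak composition (nonnegative integers). Then $$\prod_{i=1}^{n-1}\Big(1+\sum_{r=n-i+1}^{n}s_r\Big)=\sum_{\mathbf j}\binom{s_n+1}{j_1}\binom{s_{n-1}+1}{j_2}\cdots\binom{s_2+1}{j_{n-1}}\prod_{i=1}^{n-1}(j_1+\cdots+j_i-i+1)$$ $$=\sum_{\mathbf j}\left(\!\!\binom{s_n+1}{j_1}\!\!\right)\left(\!\!\binom{s_{n-1}-1}{j_2}\!\!\right)\cdots\left(\!\!\binom{s_2-1}{j_{n-1}}\!\!\right)\prod_{i=1}^{n-1}(j_1+\cdots+j_i-i+1),$$ where both sums range over weak compositions $\mathbf j=(j_1,\dots,j_{n-1})$ of $n-1$ with $\mathbf j\succeq(1,\dots,1)$, i.e. $j_1+\cdots+j_i\ge i$ for all $i$. Moreover the left-hand side is the number of elements of the $s$-weak order.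
   Context: $\left(\!\binom{m}{k}\!\right):=\binom{m+k-1}{k}$, where binomial coefficients with arbitrary integer upper entry are $\binom{x}{k}=x(x-1)\cdots(x-k+1)/k!$. The $s$-weak order is a partial order on $s$-decreasing trees: rooted plane trees with $n$ internal nodes labelled by $[n]$ such that node $i$ has $s_i+1$ (ordered) children and every descendant $j$ of $i$ satisfies $j<i$. -}

module Defs where

open import Data.Nat as N using (ℕ; zero; suc; _∸_; _≤_; _!)
open import Data.Nat.Properties using (_!≢0)
open import Data.Nat.Combinatorics using (_C_)
open import Data.Integer as ℤ using (ℤ; +_)
open import Data.Integer.DivMod using (_/ℕ_)
open import Data.Nat.ListAction using (sum; product)
open import Relation.Nullary using (Dec)
open import Data.List using (List; []; _∷_; _++_; map; foldr; take; drop; upTo; filter; concatMap; length)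
open import Data.List.Relation.Unary.All using (All)
open import Data.List.Relation.Unary.All using (all?)
open import Data.Vec using (Vec; lookup; toList)
open import Data.Fin as Fin using (Fin)
open import Data.List using (allFin)
open import Data.Fin.Base using (_<_)
open import Data.List.Relation.Binary.Permutation.Propositional using (_↭_)
open import Data.Unit using (⊤)
open import Data.Product using (_×_)
open import Relation.Binary.PropositionalEquality using (_≡_)
open import Relation.Nullary.Decidable using (_×-dec_)
open import Data.Nat.Properties using (_≟_; _≤?_)

falling : ℤ → ℕ → ℤ
falling x zero    = + 1
falling x (suc k) = x ℤ.* falling (x ℤ.- + 1) k

binom : ℤ → ℕ → ℤ
binom x k = (falling x k /ℕ (k !)) {{k !≢0}}

multichoose : ℤ → ℕ → ℤ
multichoose m k = binom (m ℤ.+ + k ℤ.- + 1) k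

-- 1-based indexing into a list (default 0 outside range; only used
-- with indices in range).

at : List ℕ → ℕ → ℕ
at []       _             = 0
at (x ∷ xs) zero          = 0
at (x ∷ xs) (suc zero)    = x
at (x ∷ xs) (suc (suc i)) = at xs (suc i)

oneTo : ℕ → List ℕ
oneTo m = map suc (upTo m)

psum : List ℕ → ℕ → ℕ
psum j i = sum (take i j)

-- Left-hand side: for s = (s_1,...,s_n), n = suc m,
--   prod_{i=1}^{n-1} (1 + sum_{r=n-i+1}^{n} s_r)
-- (the entries s_{n-i+1},...,s_n are the last i entries of s)

lhs : (m : ℕ) → Vec ℕ (suc m) → ℕ
lhs m s = product (map (λ i → suc (sum (drop (suc m ∸ i) (toList s)))) (oneTo m))

boundedVecs : ℕ → ℕ → List (List ℕ)
boundedVecs zero    b = [] ∷ []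
boundedVecs (suc k) b = concatMap (λ x → map (x ∷_) (boundedVecs k b)) (upTo (suc b))

Admissible : ℕ → List ℕ → Set
Admissible m j = (length j ≡ m) × (sum j ≡ m) × All (λ i → i ≤ psum j i) (oneTo m)

admissible? : (m : ℕ) → (j : List ℕ) → Dec (Admissible m j)
admissible? m j = (length j ≟ m) ×-dec ((sum j ≟ m) ×-dec all? (λ i → i ≤? psum j i) (oneTo m))

-- every weak composition of m into m parts has entries ≤ m,
-- so this is the full index set
indexSet : ℕ → List (List ℕ)
indexSet m = filter (admissible? m) (boundedVecs m m)

sumℤ : List ℤ → ℤ
sumℤ = foldr ℤ._+_ (+ 0)

prodℤ : List ℤ → ℤ
prodℤ = foldr ℤ._*_ (+ 1)

weightProd : ℕ → List ℕ → ℤ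
weightProd m j = prodℤ (map (λ i → + psum j i ℤ.- + i ℤ.+ + 1) (oneTo m))

-- first sum:  binom(s_n+1, j_1) binom(s_{n-1}+1, j_2) ... binom(s_2+1, j_{n-1}) * weight
-- (factor k is binom(s_{n-k+1}+1, j_k), n = suc m)
sum1 : (m : ℕ) → Vec ℕ (suc m) → ℤ
sum1 m s = sumℤ (map (λ j →
  prodℤ (map (λ k → + ((suc (at (toList s) (suc m ∸ k N.+ 1))) C (at j k))) (oneTo m))
  ℤ.* weightProd m j) (indexSet m))

multiFactor : (m : ℕ) → Vec ℕ (suc m) → List ℕ → ℕ → ℤ
multiFactor m s j 1 = multichoose (+ at (toList s) (suc m) ℤ.+ + 1) (at j 1)
multiFactor m s j k = multichoose (+ at (toList s) (suc m ∸ k N.+ 1) ℤ.- + 1) (at j k)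

sum2 : (m : ℕ) → Vec ℕ (suc m) → ℤ
sum2 m s = sumℤ (map (λ j →
  prodℤ (map (multiFactor m s j) (oneTo m)) ℤ.* weightProd m j) (indexSet m))

-- s-decreasing trees: rooted plane trees whose internal nodes are
-- labelled by Fin n (label i ↔ paper's label i+1); leaves unlabelled.

data Tree (n : ℕ) : Set where
  leaf : Tree n
  node : Fin n → List (Tree n) → Tree n

mutual
  labels : ∀ {n} → Tree n → List (Fin n)
  labels leaf        = []
  labels (node i ts) = i ∷ labelsL ts

  labelsL : ∀ {n} → List (Tree n) → List (Fin n)
  labelsL []       = []
  labelsL (t ∷ ts) = labels t ++ labelsL ts

mutual
  LocallyOK : ∀ {n} → Vec ℕ n → Tree n → Set
  LocallyOK s leaf        = ⊤
  LocallyOK s (node i ts) =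
    (length ts ≡ suc (lookup s i)) × All (λ j → j < i) (labelsL ts) × LocallyOKL s ts

  LocallyOKL : ∀ {n} → Vec ℕ n → List (Tree n) → Set
  LocallyOKL s []       = ⊤
  LocallyOKL s (t ∷ ts) = LocallyOK s t × LocallyOKL s ts

IsSDecreasing : ∀ {n} → Vec ℕ n → Tree n → Set
IsSDecreasing {n} s T = LocallyOK s T × (labels T ↭ allFin n)

{-# OPTIONS --safe #-}
module Submission where

-- Write αₖ = s_{n-k+1}, so that the left-hand side is P(0, α) with
-- P(N, α) = ∏ᵢ (1 + N + α₁ + ⋯ + αᵢ).  Summing over j one entry at a time, the
-- weight ∏ᵢ (j₁ + ⋯ + jᵢ - i + 1) peels off as (o + j₁) times the weight of the
-- tail at offset o + j₁ - 1, where o is the running value of j₁ + ⋯ + jᵢ - i.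
-- Weighting the offsets by C(N, o), the sum over j₁ becomes a Vandermonde
-- convolution C(N, ·) ∗ C(α₁ + 1, ·) = C(N + α₁ + 1, ·), and absorption
-- t C(M + 1, t) = (M + 1) C(M, t - 1) splits off the factor 1 + N + α₁, leaving the
-- same problem for the tail; this gives P(N, α).  The multichoose sum is identical
-- with offsets weighted by ((N + 2 multichoose o)): there ((α - 1 multichoose ·))
-- is again a convolution, and for α = 0 it is the difference operator 1 - X.
-- Non-admissible j never contribute, since their weight vanishes.
--
-- The s-decreasing trees with label set L arise exactly once each by replacing a
-- leaf of an s-decreasing tree with label set L ∖ {min L} by a node labelled
-- min L with s_{min L} + 1 leaves: conversely, the minimal label of a decreasing
-- tree has only leaves below it.  A tree with label set L has 1 + Σ_{l ∈ L} s_l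
-- leaves, which yields the product formula for their number.

module RangeSum where

  open import Data.Nat as ℕ using (ℕ; zero; suc; _≤_)
  import Data.Nat.Properties as ℕ
  open import Data.Integer using (ℤ; +_; _+_; _*_)
  open import Data.Integer.Properties
  open import Data.Integer.Tactic.RingSolver using (solve-∀)
  open import Data.List using (applyUpTo)
  open import Function using (_∘_)
  open import Relation.Binary.PropositionalEquality
  open import Defs using (sumℤ)
  open ≡-Reasoning

  ∑ : ℕ → (ℕ → ℤ) → ℤ
  ∑ B f = sumℤ (applyUpTo f B)

  VanishesFrom : ℕ → (ℕ → ℤ) → Set
  VanishesFrom B ψ = ∀ t → B ≤ t → ψ t ≡ + 0

  vanishesFrom-shift : ∀ B {ψ} o → VanishesFrom B ψ → VanishesFrom B (ψ ∘ (o ℕ.+_))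
  vanishesFrom-shift B o ψ↓ t B≤t = ψ↓ (o ℕ.+ t) (ℕ.≤-trans B≤t (ℕ.m≤n+m t o))

  ∑-cong : ∀ B {f g : ℕ → ℤ} → (∀ o → f o ≡ g o) → ∑ B f ≡ ∑ B g
  ∑-cong zero    f≗g = refl
  ∑-cong (suc B) f≗g = cong₂ _+_ (f≗g 0) (∑-cong B (f≗g ∘ suc))

  ∑-zero : ∀ B {f : ℕ → ℤ} → (∀ o → f o ≡ + 0) → ∑ B f ≡ + 0
  ∑-zero zero    f≗0 = refl
  ∑-zero (suc B) f≗0 = cong₂ _+_ (f≗0 0) (∑-zero B (f≗0 ∘ suc))

  ∑-+ : ∀ B (f g : ℕ → ℤ) → ∑ B (λ o → f o + g o) ≡ ∑ B f + ∑ B g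
  ∑-+ zero    f g = refl
  ∑-+ (suc B) f g = begin
    (f 0 + g 0) + ∑ B (λ o → f (suc o) + g (suc o))
      ≡⟨ cong (_+_ (f 0 + g 0)) (∑-+ B (f ∘ suc) (g ∘ suc)) ⟩
    (f 0 + g 0) + (∑ B (f ∘ suc) + ∑ B (g ∘ suc))
      ≡⟨ interchange (f 0) (g 0) (∑ B (f ∘ suc)) (∑ B (g ∘ suc)) ⟩
    (f 0 + ∑ B (f ∘ suc)) + (g 0 + ∑ B (g ∘ suc)) ∎
    where
    interchange : ∀ a b c d → (a + b) + (c + d) ≡ (a + c) + (b + d)
    interchange = solve-∀

  ∑-*ˡ : ∀ B (c : ℤ) (f : ℕ → ℤ) → ∑ B (λ o → c * f o) ≡ c * ∑ B f
  ∑-*ˡ zero    c f = sym (*-zeroʳ c)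
  ∑-*ˡ (suc B) c f = trans (cong (_+_ (c * f 0)) (∑-*ˡ B c (f ∘ suc)))
                           (sym (*-distribˡ-+ c (f 0) (∑ B (f ∘ suc))))

  ∑-last : ∀ B (f : ℕ → ℤ) → ∑ (suc B) f ≡ ∑ B f + f B
  ∑-last zero    f = trans (+-identityʳ (f 0)) (sym (+-identityˡ (f 0)))
  ∑-last (suc B) f = trans (cong (_+_ (f 0)) (∑-last B (f ∘ suc)))
                           (sym (+-assoc (f 0) (∑ B (f ∘ suc)) (f (suc B))))

  ∑-vanishing-last : ∀ B {f : ℕ → ℤ} → f B ≡ + 0 → ∑ (suc B) f ≡ ∑ B f
  ∑-vanishing-last B {f} fB≡0 = begin
    ∑ (suc B) f   ≡⟨ ∑-last B f ⟩
    ∑ B f + f B   ≡⟨ cong (_+_ (∑ B f)) fB≡0 ⟩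
    ∑ B f + + 0   ≡⟨ +-identityʳ (∑ B f) ⟩
    ∑ B f         ∎

  ∑-delta : ∀ B {κ : ℕ → ℤ} → κ 0 ≡ + 1 → (∀ x → κ (suc x) ≡ + 0) →
            ∀ (ψ : ℕ → ℤ) → ∑ (suc B) (λ x → κ x * ψ x) ≡ ψ 0
  ∑-delta B {κ} κ0≡1 κ+≡0 ψ = begin
    κ 0 * ψ 0 + ∑ B (λ x → κ (suc x) * ψ (suc x))
      ≡⟨ cong₂ _+_ (cong (_* ψ 0) κ0≡1)
                   (∑-zero B (λ x → trans (cong (_* ψ (suc x)) (κ+≡0 x)) (*-zeroˡ (ψ (suc x))))) ⟩
    + 1 * ψ 0 + + 0
      ≡⟨ trans (+-identityʳ _) (*-identityˡ (ψ 0)) ⟩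
    ψ 0 ∎

module Binomial where

  open import Data.Nat as ℕ using (ℕ; zero; suc; _∸_; _+_; _*_; _!; z≤n; s≤s)
  open import Data.Nat.Properties
  open import Data.Nat.Combinatorics using (_C_; nCk+nC[k+1]≡[n+1]C[k+1]; k>n⇒nCk≡0; nC1≡n)
  open import Data.Nat.DivMod using (m*n/n≡m)
  open import Data.Integer as ℤ using (ℤ; +_)
  import Data.Integer.Properties as ℤ
  open import Relation.Binary.Definitions using (tri<; tri≈; tri>)
  open import Relation.Binary.PropositionalEquality
  open import Defs using (falling; binom)
  open ≡-Reasoning

  pascal : ∀ n k → suc n C suc k ≡ n C k + n C suc k
  pascal n k = sym (nCk+nC[k+1]≡[n+1]C[k+1] n k)

  [k+1]*[n+1]C[k+1]≡[n+1]*nCk : ∀ n k → suc k * (suc n C suc k) ≡ suc n * (n C k)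
  [k+1]*[n+1]C[k+1]≡[n+1]*nCk zero zero = refl
  [k+1]*[n+1]C[k+1]≡[n+1]*nCk zero (suc k) =
    trans (cong (suc (suc k) *_) (k>n⇒nCk≡0 {1} {suc (suc k)} (s≤s (s≤s z≤n)))) (*-zeroʳ (suc (suc k)))
  [k+1]*[n+1]C[k+1]≡[n+1]*nCk (suc n) zero =
    trans (*-identityˡ _) (trans (nC1≡n (suc (suc n))) (sym (*-identityʳ _)))
  [k+1]*[n+1]C[k+1]≡[n+1]*nCk (suc n) (suc k) = begin
    suc (suc k) * (suc (suc n) C suc (suc k))
      ≡⟨ cong (suc (suc k) *_) (pascal (suc n) (suc k)) ⟩
    suc (suc k) * (suc n C suc k + suc n C suc (suc k))
      ≡⟨ *-distribˡ-+ (suc (suc k)) (suc n C suc k) _ ⟩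
    (suc n C suc k + suc k * (suc n C suc k)) + suc (suc k) * (suc n C suc (suc k))
      ≡⟨ cong₂ (λ a b → (suc n C suc k + a) + b)
               ([k+1]*[n+1]C[k+1]≡[n+1]*nCk n k) ([k+1]*[n+1]C[k+1]≡[n+1]*nCk n (suc k)) ⟩
    (suc n C suc k + suc n * (n C k)) + suc n * (n C suc k)
      ≡⟨ +-assoc (suc n C suc k) _ _ ⟩
    suc n C suc k + (suc n * (n C k) + suc n * (n C suc k))
      ≡⟨ cong (_+_ (suc n C suc k)) (sym (*-distribˡ-+ (suc n) (n C k) (n C suc k))) ⟩
    suc n C suc k + suc n * (n C k + n C suc k)
      ≡⟨ cong (λ c → suc n C suc k + suc n * c) (sym (pascal n k)) ⟩
    suc (suc n) * (suc n C suc k) ∎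

  [t+1]*nC[t+1]≡[n∸t]*nCt : ∀ n t → suc t * (n C suc t) ≡ (n ∸ t) * (n C t)
  [t+1]*nC[t+1]≡[n∸t]*nCt n t with <-cmp t n
  ... | tri< t<n _ _ = +-cancelʳ-≡ _ _ _ (begin
    suc t * (n C suc t) + suc t * (n C t)  ≡⟨ +-comm (suc t * (n C suc t)) _ ⟩
    suc t * (n C t) + suc t * (n C suc t)  ≡⟨ sym (*-distribˡ-+ (suc t) (n C t) _) ⟩
    suc t * (n C t + n C suc t)            ≡⟨ cong (suc t *_) (sym (pascal n t)) ⟩
    suc t * (suc n C suc t)                ≡⟨ [k+1]*[n+1]C[k+1]≡[n+1]*nCk n t ⟩
    suc n * (n C t)                        ≡⟨ cong (_* (n C t)) 1+n≡[n∸t]+[1+t] ⟩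
    ((n ∸ t) + suc t) * (n C t)            ≡⟨ *-distribʳ-+ (n C t) (n ∸ t) (suc t) ⟩
    (n ∸ t) * (n C t) + suc t * (n C t)    ∎)
    where
    1+n≡[n∸t]+[1+t] : suc n ≡ (n ∸ t) + suc t
    1+n≡[n∸t]+[1+t] = sym (trans (+-comm (n ∸ t) (suc t)) (cong suc (m+[n∸m]≡n (<⇒≤ t<n))))
  ... | tri≈ _ refl _ =
    trans (cong (suc t *_) (k>n⇒nCk≡0 (n<1+n t)))
          (trans (*-zeroʳ (suc t)) (cong (_* (t C t)) (sym (n∸n≡0 t))))
  ... | tri> _ _ t>n =
    trans (cong (suc t *_) (k>n⇒nCk≡0 (m<n⇒m<1+n t>n)))
          (trans (*-zeroʳ (suc t)) (sym (trans (cong ((n ∸ t) *_) (k>n⇒nCk≡0 t>n)) (*-zeroʳ (n ∸ t)))))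

  mchoose : ℕ → ℕ → ℕ
  mchoose A x = (A + x ∸ 1) C x

  mchoose-zero : ∀ x → mchoose 0 (suc x) ≡ 0
  mchoose-zero x = k>n⇒nCk≡0 (n<1+n x)

  mchoose-pascal : ∀ A o → mchoose (suc A) (suc o) ≡ mchoose (suc A) o + mchoose A (suc o)
  mchoose-pascal A o = begin
    (A + suc o) C suc o            ≡⟨ cong (_C suc o) (+-suc A o) ⟩
    suc (A + o) C suc o            ≡⟨ pascal (A + o) o ⟩
    (A + o) C o + (A + o) C suc o  ≡⟨ cong (λ c → (A + o) C o + (c ∸ 1) C suc o) (sym (+-suc A o)) ⟩
    (A + o) C o + (A + suc o ∸ 1) C suc o ∎

  mchoose-absorb : ∀ A t → suc t * mchoose A (suc t) ≡ A * mchoose (suc A) t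
  mchoose-absorb A t = begin
    suc t * ((A + suc t ∸ 1) C suc t)  ≡⟨ cong (λ c → suc t * ((c ∸ 1) C suc t)) (+-suc A t) ⟩
    suc t * ((A + t) C suc t)          ≡⟨ [t+1]*nC[t+1]≡[n∸t]*nCt (A + t) t ⟩
    (A + t ∸ t) * ((A + t) C t)        ≡⟨ cong (_* ((A + t) C t)) (m+n∸n≡m A t) ⟩
    A * ((A + t) C t)                  ∎

  falling-ℕ : ∀ n k → falling (+ n) k ≡ + (k ! * (n C k))
  falling-ℕ n       zero    = refl
  falling-ℕ zero    (suc k) = sym (cong +_ (*-zeroʳ (suc k !)))
  falling-ℕ (suc n) (suc k) = begin
    + suc n ℤ.* falling (+ n) k        ≡⟨ cong (+ suc n ℤ.*_) (falling-ℕ n k) ⟩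
    + suc n ℤ.* + (k ! * (n C k))      ≡⟨ sym (ℤ.pos-* (suc n) _) ⟩
    + (suc n * (k ! * (n C k)))        ≡⟨ cong +_ (x∙yz≈y∙xz (suc n) (k !) (n C k)) ⟩
    + (k ! * (suc n * (n C k)))        ≡⟨ cong (λ c → + (k ! * c)) (sym ([k+1]*[n+1]C[k+1]≡[n+1]*nCk n k)) ⟩
    + (k ! * (suc k * (suc n C suc k))) ≡⟨ cong +_ (sym (*-assoc (k !) (suc k) _)) ⟩
    + (k ! * suc k * (suc n C suc k))  ≡⟨ cong (λ c → + (c * (suc n C suc k))) (*-comm (k !) (suc k)) ⟩
    + (suc k ! * (suc n C suc k))      ∎
    where open import Algebra.Properties.CommutativeSemigroup *-commutativeSemigroup using (x∙yz≈y∙xz)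

  binom-ℕ : ∀ n k → binom (+ n) k ≡ + (n C k)
  binom-ℕ n k = trans (cong (λ z → (z ℤ./ℕ (k !)) {{k !≢0}}) (falling-ℕ n k))
                      (cong +_ (trans (cong (λ z → (z ℕ./ (k !)) {{k !≢0}}) (*-comm (k !) (n C k)))
                                      (m*n/n≡m (n C k) (k !) {{k !≢0}})))

module Transforms where

  open import Data.Nat as ℕ using (ℕ; zero; suc; _∸_; z≤n; s≤s)
  import Data.Nat.Properties as ℕ
  open import Data.Nat.Combinatorics using (_C_)
  open import Data.Integer using (ℤ; +_; _+_; _*_; -_; _-_)
  open import Data.Integer.Properties
  open import Data.Integer.Tactic.RingSolver using (solve-∀)
  open import Function using (_∘_)
  open import Relation.Binary.PropositionalEquality
  open RangeSum
  open Binomial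
  open ≡-Reasoning

  binomialℤ : ℕ → ℕ → ℤ
  binomialℤ n k = + (n C k)

  multichooseℤ : ℕ → ℕ → ℤ
  multichooseℤ A k = + mchoose A k

  ∑-by-parts : ∀ B {κ ρ ν ψ : ℕ → ℤ} → ν 0 ≡ κ 0 → (∀ o → ν (suc o) ≡ κ (suc o) + ρ o) →
               VanishesFrom (suc B) ψ →
               ∑ (suc B) (λ o → κ o * ψ o + ρ o * ψ (suc o)) ≡ ∑ (suc B) (λ o → ν o * ψ o)
  ∑-by-parts B {κ} {ρ} {ν} {ψ} ν₀ ν₊ ψ↓ = begin
    ∑ (suc B) (λ o → κ o * ψ o + ρ o * ψ (suc o))
      ≡⟨ ∑-+ (suc B) (λ o → κ o * ψ o) (λ o → ρ o * ψ (suc o)) ⟩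
    (κ 0 * ψ 0 + ∑ B (λ o → κ (suc o) * ψ (suc o))) + ∑ (suc B) (λ o → ρ o * ψ (suc o))
      ≡⟨ cong (_+_ (κ 0 * ψ 0 + ∑ B (λ o → κ (suc o) * ψ (suc o)))) (∑-vanishing-last B ρψ₊B≡0) ⟩
    (κ 0 * ψ 0 + ∑ B (λ o → κ (suc o) * ψ (suc o))) + ∑ B (λ o → ρ o * ψ (suc o))
      ≡⟨ +-assoc (κ 0 * ψ 0) _ _ ⟩
    κ 0 * ψ 0 + (∑ B (λ o → κ (suc o) * ψ (suc o)) + ∑ B (λ o → ρ o * ψ (suc o)))
      ≡⟨ cong (_+_ (κ 0 * ψ 0)) (sym (∑-+ B (λ o → κ (suc o) * ψ (suc o)) (λ o → ρ o * ψ (suc o)))) ⟩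
    κ 0 * ψ 0 + ∑ B (λ o → κ (suc o) * ψ (suc o) + ρ o * ψ (suc o))
      ≡⟨ cong₂ _+_ (cong (_* ψ 0) (sym ν₀)) (∑-cong B λ o →
           trans (sym (*-distribʳ-+ (ψ (suc o)) (κ (suc o)) (ρ o))) (cong (_* ψ (suc o)) (sym (ν₊ o)))) ⟩
    ∑ (suc B) (λ o → ν o * ψ o) ∎
    where
    ρψ₊B≡0 : ρ B * ψ (suc B) ≡ + 0
    ρψ₊B≡0 = trans (cong (ρ B *_) (ψ↓ (suc B) ℕ.≤-refl)) (*-zeroʳ (ρ B))

  ∑-binomial-pascal : ∀ B n {ψ : ℕ → ℤ} → VanishesFrom (suc B) ψ →
    ∑ (suc B) (λ o → binomialℤ n o * (ψ o + ψ (suc o))) ≡ ∑ (suc B) (λ o → binomialℤ (suc n) o * ψ o)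
  ∑-binomial-pascal B n {ψ} ψ↓ = trans (∑-cong (suc B) λ o → *-distribˡ-+ (binomialℤ n o) (ψ o) (ψ (suc o)))
    (∑-by-parts B {binomialℤ n} {binomialℤ n} {binomialℤ (suc n)} refl pascalℤ ψ↓)
    where
    pascalℤ : ∀ o → binomialℤ (suc n) (suc o) ≡ binomialℤ n (suc o) + binomialℤ n o
    pascalℤ o = trans (cong +_ (pascal n o))
                      (trans (pos-+ (n C o) (n C suc o)) (+-comm (binomialℤ n o) (binomialℤ n (suc o))))

  ∑-multichoose-difference : ∀ B A {ψ : ℕ → ℤ} → VanishesFrom (suc B) ψ →
    ∑ (suc B) (λ o → multichooseℤ (suc A) o * (ψ o - ψ (suc o))) ≡ ∑ (suc B) (λ o → multichooseℤ A o * ψ o)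
  ∑-multichoose-difference B A {ψ} ψ↓ =
    trans (∑-cong (suc B) λ o → split (multichooseℤ (suc A) o) (ψ o) (ψ (suc o)))
          (∑-by-parts B {multichooseℤ (suc A)} {λ o → - multichooseℤ (suc A) o} {multichooseℤ A}
                      refl (λ o → sym (ν₊ o)) ψ↓)
    where
    split : ∀ c a b → c * (a - b) ≡ c * a + - c * b
    split = solve-∀
    cancel : ∀ a b → (a + b) + - a ≡ b
    cancel = solve-∀
    ν₊ : ∀ o → + mchoose (suc A) (suc o) + - + mchoose (suc A) o ≡ + mchoose A (suc o)
    ν₊ o = trans (cong (λ c → + c + - + mchoose (suc A) o) (mchoose-pascal A o))
                 (trans (cong (_+ - + mchoose (suc A) o) (pos-+ (mchoose (suc A) o) _))
                        (cancel (multichooseℤ (suc A) o) _))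

  ∑-absorb : ∀ B (κ : ℕ → ℤ) {κ′ : ℕ → ℤ} c → (∀ t → κ (suc t) * + suc t ≡ c * κ′ t) →
             ∀ (h : ℕ → ℤ) → h B ≡ + 0 →
             ∑ (suc B) (λ t → κ t * (+ t * h (t ∸ 1))) ≡ c * ∑ (suc B) (λ t → κ′ t * h t)
  ∑-absorb B κ {κ′} c absorb h hB≡0 = begin
    κ 0 * (+ 0 * h 0) + ∑ B (λ t → κ (suc t) * (+ suc t * h t))
      ≡⟨ cong₂ _+_ (*-zeroʳ (κ 0)) (∑-cong B λ t → trans (sym (*-assoc (κ (suc t)) _ _))
           (trans (cong (_* h t) (absorb t)) (*-assoc c (κ′ t) (h t)))) ⟩
    + 0 + ∑ B (λ t → c * (κ′ t * h t))
      ≡⟨ trans (+-identityˡ _) (∑-*ˡ B c (λ t → κ′ t * h t)) ⟩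
    c * ∑ B (λ t → κ′ t * h t)
      ≡⟨ cong (c *_) (sym (∑-vanishing-last B (trans (cong (κ′ B *_) hB≡0) (*-zeroʳ (κ′ B))))) ⟩
    c * ∑ (suc B) (λ t → κ′ t * h t) ∎

  binomial-absorb : ∀ M t → binomialℤ (suc M) (suc t) * + suc t ≡ + suc M * binomialℤ M t
  binomial-absorb M t = begin
    + (suc M C suc t) * + suc t    ≡⟨ sym (pos-* (suc M C suc t) (suc t)) ⟩
    + ((suc M C suc t) ℕ.* suc t)  ≡⟨ cong +_ (trans (ℕ.*-comm _ (suc t)) ([k+1]*[n+1]C[k+1]≡[n+1]*nCk M t)) ⟩
    + (suc M ℕ.* (M C t))          ≡⟨ pos-* (suc M) (M C t) ⟩
    + suc M * + (M C t)            ∎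

  multichoose-absorb : ∀ K t → multichooseℤ K (suc t) * + suc t ≡ + K * multichooseℤ (suc K) t
  multichoose-absorb K t = begin
    + mchoose K (suc t) * + suc t    ≡⟨ sym (pos-* (mchoose K (suc t)) (suc t)) ⟩
    + (mchoose K (suc t) ℕ.* suc t)  ≡⟨ cong +_ (trans (ℕ.*-comm _ (suc t)) (mchoose-absorb K t)) ⟩
    + (K ℕ.* mchoose (suc K) t)      ≡⟨ pos-* K (mchoose (suc K) t) ⟩
    + K * + mchoose (suc K) t        ∎

  module Convolution
    (κ : ℕ → ℕ → ℤ) (κ₀₀ : κ 0 0 ≡ + 1) (κ₀₊ : ∀ x → κ 0 (suc x) ≡ + 0)
    (D : ℕ → (ℕ → ℤ) → ℕ → ℤ)
    (D-shift : ∀ B ψ o x → D B (ψ ∘ (o ℕ.+_)) x ≡ D B ψ (o ℕ.+ x))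
    (D-vanishes : ∀ B ψ → VanishesFrom B ψ → VanishesFrom B (D B ψ))
    (κ-step : ∀ B k ψ → VanishesFrom (suc B) ψ →
              ∑ (suc B) (λ x → κ (suc k) x * ψ x) ≡ ∑ (suc B) (λ x → κ k x * D (suc B) ψ x))
    where

    convolution : ∀ B k N ψ → VanishesFrom B ψ →
      ∑ B (λ o → κ N o * ∑ B (λ x → κ k x * ψ (o ℕ.+ x))) ≡ ∑ B (λ o → κ (N ℕ.+ k) o * ψ o)
    convolution zero    k       N ψ ψ↓ = refl
    convolution (suc B) zero    N ψ ψ↓ = ∑-cong (suc B) λ o →
      cong₂ (λ M y → κ M o * y) (sym (ℕ.+-identityʳ N))
            (trans (∑-delta B {κ 0} κ₀₀ κ₀₊ (ψ ∘ (o ℕ.+_))) (cong ψ (ℕ.+-identityʳ o)))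
    convolution (suc B) (suc k) N ψ ψ↓ = begin
      ∑ (suc B) (λ o → κ N o * ∑ (suc B) (λ x → κ (suc k) x * ψ (o ℕ.+ x)))
        ≡⟨ ∑-cong (suc B) (λ o → cong (κ N o *_) (inner o)) ⟩
      ∑ (suc B) (λ o → κ N o * ∑ (suc B) (λ x → κ k x * Dψ (o ℕ.+ x)))
        ≡⟨ convolution (suc B) k N Dψ (D-vanishes (suc B) ψ ψ↓) ⟩
      ∑ (suc B) (λ o → κ (N ℕ.+ k) o * Dψ o)
        ≡⟨ sym (κ-step B (N ℕ.+ k) ψ ψ↓) ⟩
      ∑ (suc B) (λ o → κ (suc (N ℕ.+ k)) o * ψ o)
        ≡⟨ ∑-cong (suc B) (λ o → cong (λ M → κ M o * ψ o) (sym (ℕ.+-suc N k))) ⟩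
      ∑ (suc B) (λ o → κ (N ℕ.+ suc k) o * ψ o) ∎
      where
      Dψ = D (suc B) ψ
      inner : ∀ o → ∑ (suc B) (λ x → κ (suc k) x * ψ (o ℕ.+ x)) ≡ ∑ (suc B) (λ x → κ k x * Dψ (o ℕ.+ x))
      inner o = trans (κ-step B k (ψ ∘ (o ℕ.+_)) (vanishesFrom-shift (suc B) o ψ↓))
                      (∑-cong (suc B) λ x → cong (κ k x *_) (D-shift (suc B) ψ o x))

  module BinomialConvolution = Convolution binomialℤ refl (λ _ → refl)
    (λ _ ψ t → ψ t + ψ (suc t))
    (λ _ ψ o x → cong (λ y → ψ (o ℕ.+ x) + ψ y) (ℕ.+-suc o x))
    (λ B ψ ψ↓ t B≤t → cong₂ _+_ (ψ↓ t B≤t) (ψ↓ (suc t) (ℕ.m≤n⇒m≤1+n B≤t)))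
    (λ B k ψ ψ↓ → sym (∑-binomial-pascal B k ψ↓))

  suffixSum : ℕ → (ℕ → ℤ) → ℕ → ℤ
  suffixSum B φ t = ∑ B (λ y → φ (t ℕ.+ y))

  suffixSum-vanishes : ∀ B φ → VanishesFrom B φ → VanishesFrom B (suffixSum B φ)
  suffixSum-vanishes B φ φ↓ t B≤t = ∑-zero B (λ y → φ↓ (t ℕ.+ y) (ℕ.≤-trans B≤t (ℕ.m≤m+n t y)))

  suffixSum-difference : ∀ B φ → VanishesFrom B φ → ∀ t → suffixSum B φ t - suffixSum B φ (suc t) ≡ φ t
  suffixSum-difference zero    φ φ↓ t = sym (φ↓ t z≤n)
  suffixSum-difference (suc B) φ φ↓ t = begin
    (φ (t ℕ.+ 0) + ∑ B (λ y → φ (t ℕ.+ suc y))) - ∑ (suc B) (λ y → φ (suc t ℕ.+ y))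
      ≡⟨ cong₂ (λ a b → (φ a + ∑ B (λ y → φ (t ℕ.+ suc y))) - b)
               (ℕ.+-identityʳ t) (∑-vanishing-last B (φ↓ (suc t ℕ.+ B) (s≤s (ℕ.m≤n+m B t)))) ⟩
    (φ t + ∑ B (λ y → φ (t ℕ.+ suc y))) - ∑ B (λ y → φ (suc t ℕ.+ y))
      ≡⟨ cong (λ c → (φ t + c) - ∑ B (λ y → φ (suc t ℕ.+ y))) (∑-cong B (λ y → cong φ (ℕ.+-suc t y))) ⟩
    (φ t + ∑ B (λ y → φ (suc t ℕ.+ y))) - ∑ B (λ y → φ (suc t ℕ.+ y))
      ≡⟨ cancel (φ t) _ ⟩
    φ t ∎
    where
    cancel : ∀ a b → (a + b) - b ≡ a
    cancel = solve-∀

  module MultichooseConvolution = Convolution multichooseℤ refl (λ x → cong +_ (mchoose-zero x))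
    suffixSum
    (λ B ψ o x → ∑-cong B (λ y → cong ψ (sym (ℕ.+-assoc o x y))))
    suffixSum-vanishes
    (λ B k ψ ψ↓ → trans (∑-cong (suc B) λ x → cong (multichooseℤ (suc k) x *_)
                                 (sym (suffixSum-difference (suc B) ψ ψ↓ x)))
                        (∑-multichoose-difference B k (suffixSum-vanishes (suc B) ψ ψ↓)))

  -- ((a - 1) multichoose x); for a = 0 these are the coefficients of 1 - X
  multichoosePred : ℕ → ℕ → ℤ
  multichoosePred zero    zero          = + 1
  multichoosePred zero    (suc zero)    = - + 1
  multichoosePred zero    (suc (suc _)) = + 0
  multichoosePred (suc A) x             = multichooseℤ A x

  ∑-difference : ∀ B (φ : ℕ → ℤ) → VanishesFrom (suc B) φ →
                 ∑ (suc B) (λ x → multichoosePred 0 x * φ x) ≡ φ 0 - φ 1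
  ∑-difference zero    φ φ↓ = begin
    + 1 * φ 0 + + 0   ≡⟨ trans (+-identityʳ _) (*-identityˡ (φ 0)) ⟩
    φ 0               ≡⟨ sym (trans (cong (_-_ (φ 0)) (φ↓ 1 ℕ.≤-refl)) (+-identityʳ (φ 0))) ⟩
    φ 0 - φ 1         ∎
  ∑-difference (suc B) φ φ↓ = begin
    + 1 * φ 0 + (- + 1 * φ 1 + ∑ B (λ x → + 0 * φ (suc (suc x))))
      ≡⟨ cong (λ c → + 1 * φ 0 + (- + 1 * φ 1 + c)) (∑-zero B (λ x → *-zeroˡ (φ (suc (suc x))))) ⟩
    + 1 * φ 0 + (- + 1 * φ 1 + + 0)
      ≡⟨ simplify (φ 0) (φ 1) ⟩
    φ 0 - φ 1 ∎
    where
    simplify : ∀ p q → + 1 * p + (- + 1 * q + + 0) ≡ p - q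
    simplify = solve-∀

  multichoosePred-convolution : ∀ B K a ψ → VanishesFrom (suc B) ψ →
    ∑ (suc B) (λ o → multichooseℤ (suc K) o * ∑ (suc B) (λ x → multichoosePred a x * ψ (o ℕ.+ x)))
      ≡ ∑ (suc B) (λ o → multichooseℤ (K ℕ.+ a) o * ψ o)
  multichoosePred-convolution B K zero ψ ψ↓ = begin
    ∑ (suc B) (λ o → multichooseℤ (suc K) o * ∑ (suc B) (λ x → multichoosePred 0 x * ψ (o ℕ.+ x)))
      ≡⟨ ∑-cong (suc B) (λ o → cong (multichooseℤ (suc K) o *_)
           (trans (∑-difference B (ψ ∘ (o ℕ.+_)) (vanishesFrom-shift (suc B) o ψ↓))
                  (cong₂ (λ a b → ψ a - ψ b) (ℕ.+-identityʳ o) (ℕ.+-comm o 1)))) ⟩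
    ∑ (suc B) (λ o → multichooseℤ (suc K) o * (ψ o - ψ (suc o)))
      ≡⟨ ∑-multichoose-difference B K ψ↓ ⟩
    ∑ (suc B) (λ o → multichooseℤ K o * ψ o)
      ≡⟨ ∑-cong (suc B) (λ o → cong (λ M → multichooseℤ M o * ψ o) (sym (ℕ.+-identityʳ K))) ⟩
    ∑ (suc B) (λ o → multichooseℤ (K ℕ.+ 0) o * ψ o) ∎
  multichoosePred-convolution B K (suc A) ψ ψ↓ =
    trans (MultichooseConvolution.convolution (suc B) A (suc K) ψ ψ↓)
          (∑-cong (suc B) (λ o → cong (λ M → multichooseℤ M o * ψ o) (sym (ℕ.+-suc K A))))

module WeightedSum where

  open import Data.Nat as ℕ using (ℕ; zero; suc; _∸_)
  import Data.Nat.Properties as ℕ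
  open import Data.Integer using (ℤ; +_; _+_; _*_)
  open import Data.Integer.Properties
  open import Data.Integer.Tactic.RingSolver using (solve-∀)
  open import Data.List using (List; []; _∷_; map; _++_; concatMap; upTo)
  import Data.List.Properties as List
  open import Function using (_∘_)
  open import Relation.Binary.PropositionalEquality
  open import Defs using (sumℤ; boundedVecs)
  open RangeSum
  open ≡-Reasoning

  sumℤ-++ : ∀ xs ys → sumℤ (xs ++ ys) ≡ sumℤ xs + sumℤ ys
  sumℤ-++ []       ys = sym (+-identityˡ _)
  sumℤ-++ (x ∷ xs) ys = trans (cong (_+_ x) (sumℤ-++ xs ys)) (sym (+-assoc x (sumℤ xs) (sumℤ ys)))

  sumℤ-concatMap : ∀ {A B : Set} (g : B → ℤ) (h : A → List B) (xs : List A) →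
    sumℤ (map g (concatMap h xs)) ≡ sumℤ (map (λ x → sumℤ (map g (h x))) xs)
  sumℤ-concatMap g h []       = refl
  sumℤ-concatMap g h (x ∷ xs) = begin
    sumℤ (map g (h x ++ concatMap h xs))               ≡⟨ cong sumℤ (List.map-++ g (h x) (concatMap h xs)) ⟩
    sumℤ (map g (h x) ++ map g (concatMap h xs))       ≡⟨ sumℤ-++ (map g (h x)) _ ⟩
    sumℤ (map g (h x)) + sumℤ (map g (concatMap h xs)) ≡⟨ cong (_+_ (sumℤ (map g (h x)))) (sumℤ-concatMap g h xs) ⟩
    sumℤ (map g (h x)) + sumℤ (map (λ x → sumℤ (map g (h x))) xs) ∎

  sumℤ-map-*ˡ : ∀ {A : Set} (c : ℤ) (g : A → ℤ) (xs : List A) →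
    sumℤ (map (λ x → c * g x) xs) ≡ c * sumℤ (map g xs)
  sumℤ-map-*ˡ c g []       = sym (*-zeroʳ c)
  sumℤ-map-*ˡ c g (x ∷ xs) = trans (cong (_+_ (c * g x)) (sumℤ-map-*ˡ c g xs)) (sym (*-distribˡ-+ c (g x) _))

  δ₀ : ℕ → ℕ
  δ₀ zero    = 1
  δ₀ (suc _) = 0

  -- weight 0 j = ∏ᵢ (j₁ + ⋯ + jᵢ - i + 1) when j is admissible, and 0 otherwise;
  -- the offset o carries the running value of j₁ + ⋯ + jᵢ - i
  weight : ℕ → List ℕ → ℕ
  weight o []      = δ₀ o
  weight o (x ∷ j) = (o ℕ.+ x) ℕ.* weight (o ℕ.+ x ∸ 1) j

  factorProduct : (ℕ → ℕ → ℤ) → List ℕ → ℤ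
  factorProduct f []      = + 1
  factorProduct f (x ∷ j) = f 1 x * factorProduct (f ∘ suc) j

  factorProduct-cong : ∀ {f g : ℕ → ℕ → ℤ} → (∀ k x → f (suc k) x ≡ g (suc k) x) →
                       ∀ j → factorProduct f j ≡ factorProduct g j
  factorProduct-cong f≗g []      = refl
  factorProduct-cong f≗g (x ∷ j) = cong₂ _*_ (f≗g 0 x) (factorProduct-cong (f≗g ∘ suc) j)

  weightedSum : ℕ → (ℕ → ℕ → ℤ) → ℕ → ℕ → ℤ
  weightedSum b f o r = sumℤ (map (λ j → factorProduct f j * + weight o j) (boundedVecs r b))

  weightedSum-cong : ∀ {f g : ℕ → ℕ → ℤ} → (∀ k x → f (suc k) x ≡ g (suc k) x) →
                     ∀ b o r → weightedSum b f o r ≡ weightedSum b g o r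
  weightedSum-cong f≗g b o r =
    cong sumℤ (List.map-cong (λ j → cong (_* + weight o j) (factorProduct-cong f≗g j)) (boundedVecs r b))

  weightedSum-zero : ∀ b f o → weightedSum b f o 0 ≡ + δ₀ o
  weightedSum-zero b f o = trans (+-identityʳ _) (*-identityˡ _)

  weightedSum-suc : ∀ b f o r → weightedSum b f o (suc r) ≡
    ∑ (suc b) (λ x → f 1 x * (+ (o ℕ.+ x) * weightedSum b (f ∘ suc) (o ℕ.+ x ∸ 1) r))
  weightedSum-suc b f o r = begin
    sumℤ (map term (concatMap (λ x → map (x ∷_) (boundedVecs r b)) (upTo (suc b))))
      ≡⟨ sumℤ-concatMap term (λ x → map (x ∷_) (boundedVecs r b)) (upTo (suc b)) ⟩
    sumℤ (map (λ x → sumℤ (map term (map (x ∷_) (boundedVecs r b)))) (upTo (suc b)))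
      ≡⟨ cong sumℤ (List.map-upTo (λ x → sumℤ (map term (map (x ∷_) (boundedVecs r b)))) (suc b)) ⟩
    ∑ (suc b) (λ x → sumℤ (map term (map (x ∷_) (boundedVecs r b))))
      ≡⟨ ∑-cong (suc b) first-entry ⟩
    ∑ (suc b) (λ x → f 1 x * (+ (o ℕ.+ x) * weightedSum b (f ∘ suc) (o ℕ.+ x ∸ 1) r)) ∎
    where
    term : List ℕ → ℤ
    term j = factorProduct f j * + weight o j
    reassoc : ∀ a p q w → (a * p) * (q * w) ≡ a * (q * (p * w))
    reassoc = solve-∀
    first-entry : ∀ x → sumℤ (map term (map (x ∷_) (boundedVecs r b)))
                        ≡ f 1 x * (+ (o ℕ.+ x) * weightedSum b (f ∘ suc) (o ℕ.+ x ∸ 1) r)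
    first-entry x = begin
      sumℤ (map term (map (x ∷_) (boundedVecs r b)))
        ≡⟨ cong sumℤ (sym (List.map-∘ (boundedVecs r b))) ⟩
      sumℤ (map (λ j → term (x ∷ j)) (boundedVecs r b))
        ≡⟨ cong sumℤ (List.map-cong (λ j → trans
             (cong ((f 1 x * factorProduct (f ∘ suc) j) *_) (pos-* (o ℕ.+ x) (weight (o ℕ.+ x ∸ 1) j)))
             (reassoc (f 1 x) (factorProduct (f ∘ suc) j) (+ (o ℕ.+ x)) (+ weight (o ℕ.+ x ∸ 1) j)))
             (boundedVecs r b)) ⟩
      sumℤ (map (λ j → f 1 x * (+ (o ℕ.+ x) * (factorProduct (f ∘ suc) j * + weight (o ℕ.+ x ∸ 1) j))) (boundedVecs r b))
        ≡⟨ sumℤ-map-*ˡ (f 1 x) _ (boundedVecs r b) ⟩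
      f 1 x * sumℤ (map (λ j → + (o ℕ.+ x) * (factorProduct (f ∘ suc) j * + weight (o ℕ.+ x ∸ 1) j)) (boundedVecs r b))
        ≡⟨ cong (f 1 x *_) (sumℤ-map-*ˡ (+ (o ℕ.+ x)) _ (boundedVecs r b)) ⟩
      f 1 x * (+ (o ℕ.+ x) * weightedSum b (f ∘ suc) (o ℕ.+ x ∸ 1) r) ∎

  weightedSum-vanishes : ∀ b f r o → r ℕ.< o → weightedSum b f o r ≡ + 0
  weightedSum-vanishes b f zero    (suc o) _   = weightedSum-zero b f (suc o)
  weightedSum-vanishes b f (suc r) o       r<o = trans (weightedSum-suc b f o r) (∑-zero (suc b) λ x →
    trans (cong (λ c → f 1 x * (+ (o ℕ.+ x) * c)) (weightedSum-vanishes b (f ∘ suc) r (o ℕ.+ x ∸ 1) (r<o+x∸1 x)))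
          (trans (cong (f 1 x *_) (*-zeroʳ (+ (o ℕ.+ x)))) (*-zeroʳ (f 1 x))))
    where
    r<o+x∸1 : ∀ x → r ℕ.< o ℕ.+ x ∸ 1
    r<o+x∸1 x = ℕ.≤-trans (ℕ.∸-monoˡ-≤ 1 r<o) (ℕ.∸-monoˡ-≤ 1 (ℕ.m≤m+n o x))

module ProductFormula where

  open import Data.Nat as ℕ using (ℕ; zero; suc; _∸_)
  import Data.Nat.Properties as ℕ
  open import Data.Integer using (ℤ; +_; _+_; _*_)
  open import Data.Integer.Properties
  open import Function using (_∘_)
  open import Relation.Binary.PropositionalEquality
  open RangeSum
  open Binomial
  open Transforms
  open WeightedSum
  open ≡-Reasoning

  prefixSumProduct : ℕ → (ℕ → ℕ) → ℕ → ℤ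
  prefixSumProduct N α zero    = + 1
  prefixSumProduct N α (suc r) = + suc (N ℕ.+ α 1) * prefixSumProduct (N ℕ.+ α 1) (α ∘ suc) r

  binomialFactors : (ℕ → ℕ) → ℕ → ℕ → ℤ
  binomialFactors α k = binomialℤ (suc (α k))

  multichooseFactors : (ℕ → ℕ) → ℕ → ℕ → ℤ
  multichooseFactors α k = multichoosePred (α k)

  ∑-weightedSum-zero : ∀ b (κ : ℕ → ℤ) F → κ 0 ≡ + 1 → ∑ (suc b) (λ o → κ o * weightedSum b F o 0) ≡ + 1
  ∑-weightedSum-zero b κ F κ₀ = begin
    κ 0 * weightedSum b F 0 0 + ∑ b (λ o → κ (suc o) * weightedSum b F (suc o) 0)
      ≡⟨ cong₂ _+_ (cong₂ _*_ κ₀ (weightedSum-zero b F 0)) (∑-zero b λ o →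
           trans (cong (κ (suc o) *_) (weightedSum-zero b F (suc o))) (*-zeroʳ (κ (suc o)))) ⟩
    + 1 * + 1 + + 0 ∎

  shiftedWeightedSum : ℕ → (ℕ → ℕ → ℤ) → ℕ → ℕ → ℤ
  shiftedWeightedSum b F r t = + t * weightedSum b F (t ∸ 1) r

  shiftedWeightedSum-vanishes : ∀ b F r → r ℕ.< b → VanishesFrom (suc b) (shiftedWeightedSum b F r)
  shiftedWeightedSum-vanishes b F r r<b t b<t =
    trans (cong (+ t *_) (weightedSum-vanishes b F r (t ∸ 1) (ℕ.≤-trans r<b (ℕ.∸-monoˡ-≤ 1 b<t)))) (*-zeroʳ (+ t))

  binomial-transform : ∀ b r N α → r ℕ.≤ b →
    ∑ (suc b) (λ o → binomialℤ N o * weightedSum b (binomialFactors α) o r) ≡ prefixSumProduct N α r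
  binomial-transform b zero    N α _   = ∑-weightedSum-zero b (binomialℤ N) (binomialFactors α) refl
  binomial-transform b (suc r) N α r<b = begin
    ∑ (suc b) (λ o → binomialℤ N o * weightedSum b (binomialFactors α) o (suc r))
      ≡⟨ ∑-cong (suc b) (λ o → cong (binomialℤ N o *_) (weightedSum-suc b (binomialFactors α) o r)) ⟩
    ∑ (suc b) (λ o → binomialℤ N o * ∑ (suc b) (λ x → binomialℤ (suc (α 1)) x * φ (o ℕ.+ x)))
      ≡⟨ BinomialConvolution.convolution (suc b) (suc (α 1)) N φ (shiftedWeightedSum-vanishes b _ r r<b) ⟩
    ∑ (suc b) (λ o → binomialℤ (N ℕ.+ suc (α 1)) o * φ o)
      ≡⟨ ∑-cong (suc b) (λ o → cong (λ K → binomialℤ K o * φ o) (ℕ.+-suc N (α 1))) ⟩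
    ∑ (suc b) (λ o → binomialℤ (suc N′) o * φ o)
      ≡⟨ ∑-absorb b (binomialℤ (suc N′)) (+ suc N′) (binomial-absorb N′) tail (weightedSum-vanishes b _ r b r<b) ⟩
    + suc N′ * ∑ (suc b) (λ t → binomialℤ N′ t * tail t)
      ≡⟨ cong (+ suc N′ *_) (binomial-transform b r N′ (α ∘ suc) (ℕ.<⇒≤ r<b)) ⟩
    prefixSumProduct N α (suc r) ∎
    where
    N′ = N ℕ.+ α 1
    tail = λ t → weightedSum b (binomialFactors (α ∘ suc)) t r
    φ = shiftedWeightedSum b (binomialFactors (α ∘ suc)) r

  multichoose-transform : ∀ b r M α → r ℕ.≤ b →
    ∑ (suc b) (λ o → multichooseℤ (2 ℕ.+ M) o * weightedSum b (multichooseFactors α) o r) ≡ prefixSumProduct M α r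
  multichoose-transform b zero    M α _   = ∑-weightedSum-zero b (multichooseℤ (2 ℕ.+ M)) (multichooseFactors α) refl
  multichoose-transform b (suc r) M α r<b = begin
    ∑ (suc b) (λ o → multichooseℤ (2 ℕ.+ M) o * weightedSum b (multichooseFactors α) o (suc r))
      ≡⟨ ∑-cong (suc b) (λ o → cong (multichooseℤ (2 ℕ.+ M) o *_) (weightedSum-suc b (multichooseFactors α) o r)) ⟩
    ∑ (suc b) (λ o → multichooseℤ (2 ℕ.+ M) o * ∑ (suc b) (λ x → multichoosePred (α 1) x * φ (o ℕ.+ x)))
      ≡⟨ multichoosePred-convolution b (suc M) (α 1) φ (shiftedWeightedSum-vanishes b _ r r<b) ⟩
    ∑ (suc b) (λ o → multichooseℤ (suc M′) o * φ o)
      ≡⟨ ∑-absorb b (multichooseℤ (suc M′)) (+ suc M′) (multichoose-absorb (suc M′)) tail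
           (weightedSum-vanishes b _ r b r<b) ⟩
    + suc M′ * ∑ (suc b) (λ t → multichooseℤ (2 ℕ.+ M′) t * tail t)
      ≡⟨ cong (+ suc M′ *_) (multichoose-transform b r M′ (α ∘ suc) (ℕ.<⇒≤ r<b)) ⟩
    prefixSumProduct M α (suc r) ∎
    where
    M′ = M ℕ.+ α 1
    tail = λ t → weightedSum b (multichooseFactors (α ∘ suc)) t r
    φ = shiftedWeightedSum b (multichooseFactors (α ∘ suc)) r

  weightedSum-binomialFactors : ∀ b r α → r ℕ.≤ b → weightedSum b (binomialFactors α) 0 r ≡ prefixSumProduct 0 α r
  weightedSum-binomialFactors b r α r≤b =
    trans (sym (∑-delta b {binomialℤ 0} refl (λ _ → refl) (λ o → weightedSum b (binomialFactors α) o r)))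
          (binomial-transform b r 0 α r≤b)

  weightedSum-multichooseFactors : ∀ b r α F → r ℕ.≤ b →
    (∀ x → F 1 x ≡ multichooseℤ (suc (α 1)) x) → (∀ k x → F (2 ℕ.+ k) x ≡ multichooseFactors α (2 ℕ.+ k) x) →
    weightedSum b F 0 r ≡ prefixSumProduct 0 α r
  weightedSum-multichooseFactors b zero    α F _   _  _  = weightedSum-zero b F 0
  weightedSum-multichooseFactors b (suc r) α F r<b F₁ F₊ = begin
    weightedSum b F 0 (suc r)
      ≡⟨ weightedSum-suc b F 0 r ⟩
    ∑ (suc b) (λ x → F 1 x * shiftedWeightedSum b (F ∘ suc) r x)
      ≡⟨ ∑-cong (suc b) (λ x → cong₂ (λ c w → c * (+ x * w)) (F₁ x)
           (weightedSum-cong {F ∘ suc} {multichooseFactors (α ∘ suc)} F₊ b (x ∸ 1) r)) ⟩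
    ∑ (suc b) (λ x → multichooseℤ (suc (α 1)) x * shiftedWeightedSum b (multichooseFactors (α ∘ suc)) r x)
      ≡⟨ ∑-absorb b (multichooseℤ (suc (α 1))) (+ suc (α 1)) (multichoose-absorb (suc (α 1))) tail
           (weightedSum-vanishes b _ r b r<b) ⟩
    + suc (α 1) * ∑ (suc b) (λ t → multichooseℤ (2 ℕ.+ α 1) t * tail t)
      ≡⟨ cong (+ suc (α 1) *_) (multichoose-transform b r (α 1) (α ∘ suc) (ℕ.<⇒≤ r<b)) ⟩
    prefixSumProduct 0 α (suc r) ∎
    where
    tail = λ t → weightedSum b (multichooseFactors (α ∘ suc)) t r

module IndexSet where

  open import Data.Nat as ℕ using (ℕ; zero; suc; z≤n; s≤s)
  import Data.Nat.Properties as ℕ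
  open import Data.Nat.ListAction using (sum)
  open import Data.Integer using (ℤ; +_; _+_; _*_; _-_)
  open import Data.Integer.Properties
  open import Data.Integer.Tactic.RingSolver using (solve-∀)
  open import Data.List using (List; []; _∷_; applyUpTo; map; upTo; filter; length)
  import Data.List.Properties as List
  open import Data.List.Membership.Propositional using (_∈_)
  open import Data.List.Membership.Propositional.Properties using (∈-concatMap⁻; ∈-map⁻)
  open import Data.List.Relation.Unary.Any using (here; there; satisfied)
  import Data.List.Relation.Unary.All.Properties as All
  open import Data.Product using (_×_; _,_; proj₁; proj₂)
  open import Relation.Nullary using (¬_; Dec; yes; no)
  open import Data.Empty using (⊥-elim)
  open import Function using (_∘_)
  open import Relation.Binary.PropositionalEquality
  open import Defs
  open WeightedSum
  open ≡-Reasoning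

  map-oneTo : ∀ {A : Set} (F : ℕ → A) r → map F (oneTo r) ≡ applyUpTo (F ∘ suc) r
  map-oneTo F r = trans (sym (List.map-∘ (upTo r))) (List.map-upTo (F ∘ suc) r)

  applyUpTo-cong< : ∀ {A : Set} {f g : ℕ → A} n → (∀ i → i ℕ.< n → f i ≡ g i) → applyUpTo f n ≡ applyUpTo g n
  applyUpTo-cong< zero    f≗g = refl
  applyUpTo-cong< (suc n) f≗g = cong₂ _∷_ (f≗g 0 (s≤s z≤n)) (applyUpTo-cong< n (λ i i<n → f≗g (suc i) (s≤s i<n)))

  prodℤ-at≡factorProduct : ∀ (F : ℕ → ℕ → ℤ) j →
                           prodℤ (map (λ k → F k (at j k)) (oneTo (length j))) ≡ factorProduct F j
  prodℤ-at≡factorProduct F j = trans (cong prodℤ (map-oneTo (λ k → F k (at j k)) (length j))) (go F j)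
    where
    go : ∀ (F : ℕ → ℕ → ℤ) j → prodℤ (applyUpTo (λ i → F (suc i) (at j (suc i))) (length j)) ≡ factorProduct F j
    go F []      = refl
    go F (x ∷ j) = cong (F 1 x *_) (go (F ∘ suc) j)

  n≡0⇒m*n≡0 : ∀ m {n} → n ≡ 0 → m ℕ.* n ≡ 0
  n≡0⇒m*n≡0 m refl = ℕ.*-zeroʳ m

  weight≢0⇒prefix≥ : ∀ o j → weight o j ≢ 0 → ∀ i → i ℕ.< length j → suc i ℕ.≤ o ℕ.+ psum j (suc i)
  weight≢0⇒prefix≥ o (x ∷ j) w≢0 i i<len with o ℕ.+ x in o+x≡
  ... | zero  = ⊥-elim (w≢0 refl)
  ... | suc p with i | i<len
  ...   | zero  | _         = subst (1 ℕ.≤_) (trans (sym o+x≡) (cong (o ℕ.+_) (sym (ℕ.+-identityʳ x)))) (s≤s z≤n)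
  ...   | suc i | s≤s i<len = subst (suc (suc i) ℕ.≤_) (trans (cong (ℕ._+ psum j (suc i)) (sym o+x≡)) (ℕ.+-assoc o x _))
                                (s≤s (weight≢0⇒prefix≥ p j (w≢0 ∘ n≡0⇒m*n≡0 (suc p)) i i<len))

  weight≢0⇒sum≡length : ∀ o j → weight o j ≢ 0 → o ℕ.+ sum j ≡ length j
  weight≢0⇒sum≡length zero    []      w≢0 = refl
  weight≢0⇒sum≡length (suc o) []      w≢0 = ⊥-elim (w≢0 refl)
  weight≢0⇒sum≡length o       (x ∷ j) w≢0 with o ℕ.+ x in o+x≡
  ... | zero  = ⊥-elim (w≢0 refl)
  ... | suc p = trans (sym (ℕ.+-assoc o x (sum j)))
                  (trans (cong (ℕ._+ sum j) o+x≡) (cong suc (weight≢0⇒sum≡length p j (w≢0 ∘ n≡0⇒m*n≡0 (suc p)))))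

  offsetWeightProd : ℕ → List ℕ → ℤ
  offsetWeightProd o j = prodℤ (applyUpTo (λ i → + (o ℕ.+ psum j (suc i)) - + suc i + + 1) (length j))

  offsetWeightProd≡weight : ∀ o j → (∀ i → i ℕ.< length j → suc i ℕ.≤ o ℕ.+ psum j (suc i)) →
                             o ℕ.+ sum j ≡ length j → offsetWeightProd o j ≡ + weight o j
  offsetWeightProd≡weight zero [] _ _ = refl
  offsetWeightProd≡weight o (x ∷ j) prefix≥ sum≡ with o ℕ.+ x in o+x≡ | prefix≥ 0 (s≤s z≤n)
  ... | zero  | 1≤o+x =
    ⊥-elim (ℕ.1+n≰n (ℕ.≤-trans 1≤o+x (ℕ.≤-reflexive (trans (cong (o ℕ.+_) (ℕ.+-identityʳ x)) o+x≡))))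
  ... | suc p | _     = begin
    (+ (o ℕ.+ (x ℕ.+ 0)) - + 1 + + 1)
      * prodℤ (applyUpTo (λ i → + (o ℕ.+ (x ℕ.+ psum j (suc i))) - + suc (suc i) + + 1) (length j))
      ≡⟨ cong₂ _*_ (trans (-1+1 _) (cong +_ (trans (cong (o ℕ.+_) (ℕ.+-identityʳ x)) o+x≡)))
                   (cong prodℤ (applyUpTo-cong< (length j) (λ i _ → tail-factor i))) ⟩
    + suc p * offsetWeightProd p j
      ≡⟨ cong (+ suc p *_) (offsetWeightProd≡weight p j prefix≥′ (ℕ.suc-injective (trans (sym (o+x+ (sum j))) sum≡))) ⟩
    + suc p * + weight p j
      ≡⟨ sym (pos-* (suc p) (weight p j)) ⟩
    + (suc p ℕ.* weight p j) ∎
    where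
    -1+1 : ∀ a → a - + 1 + + 1 ≡ a
    -1+1 = solve-∀
    shift : ∀ y i → (+ 1 + y) - (+ 1 + i) + + 1 ≡ y - i + + 1
    shift = solve-∀
    o+x+ : ∀ q → o ℕ.+ (x ℕ.+ q) ≡ suc (p ℕ.+ q)
    o+x+ q = trans (sym (ℕ.+-assoc o x q)) (cong (ℕ._+ q) o+x≡)
    tail-factor : ∀ i → + (o ℕ.+ (x ℕ.+ psum j (suc i))) - + suc (suc i) + + 1 ≡ + (p ℕ.+ psum j (suc i)) - + suc i + + 1
    tail-factor i = trans (cong (λ c → + c - + suc (suc i) + + 1) (o+x+ (psum j (suc i))))
                          (shift (+ (p ℕ.+ psum j (suc i))) (+ suc i))
    prefix≥′ : ∀ i → i ℕ.< length j → suc i ℕ.≤ p ℕ.+ psum j (suc i)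
    prefix≥′ i i<len = ℕ.≤-pred (ℕ.≤-trans (prefix≥ (suc i) (s≤s i<len)) (ℕ.≤-reflexive (o+x+ (psum j (suc i)))))

  ∈-boundedVecs⇒length : ∀ r b j → j ∈ boundedVecs r b → length j ≡ r
  ∈-boundedVecs⇒length zero    b .[] (here refl) = refl
  ∈-boundedVecs⇒length (suc r) b j   j∈
    with satisfied (∈-concatMap⁻ (λ x → map (x ∷_) (boundedVecs r b)) {xs = upTo (suc b)} j∈)
  ... | x , j∈x∷ with ∈-map⁻ (x ∷_) j∈x∷
  ... | v , v∈ , refl = cong suc (∈-boundedVecs⇒length r b v v∈)

  sumℤ-filter : ∀ {A : Set} {P : A → Set} (P? : ∀ x → Dec (P x)) (F G : A → ℤ) (xs : List A) →
    (∀ x → x ∈ xs → (P x → F x ≡ G x) × (¬ P x → G x ≡ + 0)) →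
    sumℤ (map F (filter P? xs)) ≡ sumℤ (map G xs)
  sumℤ-filter P? F G []       F≈G = refl
  sumℤ-filter P? F G (x ∷ xs) F≈G with P? x
  ... | yes Px = cong₂ _+_ (proj₁ (F≈G x (here refl)) Px) (sumℤ-filter P? F G xs (λ y → F≈G y ∘ there))
  ... | no ¬Px = trans (sumℤ-filter P? F G xs (λ y → F≈G y ∘ there))
                       (sym (trans (cong (_+ sumℤ (map G xs)) (proj₂ (F≈G x (here refl)) ¬Px)) (+-identityˡ _)))

  indexSet-sum≡weightedSum : ∀ m (F : ℕ → ℕ → ℤ) →
    sumℤ (map (λ j → prodℤ (map (λ k → F k (at j k)) (oneTo m)) * weightProd m j) (indexSet m)) ≡ weightedSum m F 0 m
  indexSet-sum≡weightedSum m F = sumℤ-filter (admissible? m) _ (λ j → factorProduct F j * + weight 0 j) (boundedVecs m m)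
    λ j j∈ → admissible⇒ j , inadmissible⇒ j (∈-boundedVecs⇒length m m j j∈)
    where
    admissible⇒ : ∀ j → Admissible m j → _ ≡ factorProduct F j * + weight 0 j
    admissible⇒ j (refl , sum≡ , prefix≥) = cong₂ _*_ (prodℤ-at≡factorProduct F j)
      (trans (cong prodℤ (map-oneTo _ (length j)))
             (offsetWeightProd≡weight 0 j (λ i → All.applyUpTo⁻ (λ x → x) (length j) (All.map⁻ prefix≥)) sum≡))
    inadmissible⇒ : ∀ j → length j ≡ m → ¬ Admissible m j → factorProduct F j * + weight 0 j ≡ + 0
    inadmissible⇒ j len≡ ¬adm with weight 0 j ℕ.≟ 0
    ... | yes w≡0 = trans (cong (λ w → factorProduct F j * + w) w≡0) (*-zeroʳ (factorProduct F j))
    ... | no  w≢0 = ⊥-elim (¬adm (len≡ , trans (weight≢0⇒sum≡length 0 j w≢0) len≡ ,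
                      All.map⁺ (All.applyUpTo⁺₁ (λ x → x) m
                        (λ {i} i<m → weight≢0⇒prefix≥ 0 j w≢0 i (subst (i ℕ.<_) (sym len≡) i<m)))))

module Evaluation where

  open import Data.Nat as ℕ using (ℕ; zero; suc; _∸_; s≤s)
  import Data.Nat.Properties as ℕ
  open import Data.Nat.Combinatorics using (_C_; k>n⇒nCk≡0)
  open import Data.Nat.ListAction using (sum; product)
  open import Data.Integer using (ℤ; +_; _+_; _*_; _-_)
  open import Data.Integer.Properties
  open import Data.Integer.Tactic.RingSolver using (solve-∀)
  open import Data.List using (List; []; _∷_; applyUpTo; map; length; drop)
  import Data.List.Properties as List
  open import Data.Vec using (Vec; toList)
  open import Data.Vec.Properties using (length-toList)
  open import Function using (_∘_)
  open import Relation.Binary.PropositionalEquality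
  open import Defs
  open Binomial
  open Transforms
  open WeightedSum
  open ProductFormula
  open IndexSet
  open ≡-Reasoning

  multichoose-ℕ+1 : ∀ a x → multichoose (+ a + + 1) x ≡ multichooseℤ (suc a) x
  multichoose-ℕ+1 a x = trans (cong (λ y → binom y x) (trans (reorder (+ a) (+ x)) (sym (pos-+ a x))))
                                (binom-ℕ (a ℕ.+ x) x)
    where
    reorder : ∀ p q → p + + 1 + q - + 1 ≡ p + q
    reorder = solve-∀

  multichoose-ℕ-1 : ∀ a x → multichoose (+ a - + 1) x ≡ multichoosePred a x
  multichoose-ℕ-1 zero    zero          = refl
  multichoose-ℕ-1 zero    (suc zero)    = refl
  multichoose-ℕ-1 zero    (suc (suc x)) =
    trans (cong (λ y → binom y (suc (suc x))) (reorder (+ x)))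
          (trans (binom-ℕ x (suc (suc x))) (cong +_ (k>n⇒nCk≡0 (ℕ.m<n⇒m<1+n (ℕ.n<1+n x)))))
    where
    reorder : ∀ q → + 0 - + 1 + (+ 1 + (+ 1 + q)) - + 1 ≡ q
    reorder = solve-∀
  multichoose-ℕ-1 (suc A) zero    = refl
  multichoose-ℕ-1 (suc A) (suc x) =
    trans (cong (λ y → binom y (suc x)) (trans (reorder (+ A) (+ x)) (sym (pos-+ A x))))
          (trans (binom-ℕ (A ℕ.+ x) (suc x)) (cong (λ c → + ((c ∸ 1) C suc x)) (sym (ℕ.+-suc A x))))
    where
    reorder : ∀ p q → + 1 + p - + 1 + (+ 1 + q) - + 1 ≡ p + q
    reorder = solve-∀

  prefixSum : (ℕ → ℕ) → ℕ → ℕ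
  prefixSum β zero    = 0
  prefixSum β (suc i) = β 1 ℕ.+ prefixSum (β ∘ suc) i

  prefixSum-suc : ∀ β i → prefixSum β (suc i) ≡ prefixSum β i ℕ.+ β (suc i)
  prefixSum-suc β zero    = ℕ.+-identityʳ (β 1)
  prefixSum-suc β (suc i) = trans (cong (β 1 ℕ.+_) (prefixSum-suc (β ∘ suc) i)) (sym (ℕ.+-assoc (β 1) _ _))

  prefixSumProduct≡product : ∀ N β r →
    prefixSumProduct N β r ≡ + product (applyUpTo (λ i → suc (N ℕ.+ prefixSum β (suc i))) r)
  prefixSumProduct≡product N β zero    = refl
  prefixSumProduct≡product N β (suc r) = begin
    + suc (N ℕ.+ β 1) * prefixSumProduct (N ℕ.+ β 1) (β ∘ suc) r
      ≡⟨ cong (+ suc (N ℕ.+ β 1) *_) (prefixSumProduct≡product (N ℕ.+ β 1) (β ∘ suc) r) ⟩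
    + suc (N ℕ.+ β 1) * + product (applyUpTo (λ i → suc (N ℕ.+ β 1 ℕ.+ prefixSum (β ∘ suc) (suc i))) r)
      ≡⟨ sym (pos-* (suc (N ℕ.+ β 1)) _) ⟩
    + (suc (N ℕ.+ β 1) ℕ.* product (applyUpTo (λ i → suc (N ℕ.+ β 1 ℕ.+ prefixSum (β ∘ suc) (suc i))) r))
      ≡⟨ cong₂ (λ y z → + (suc y ℕ.* product z)) (cong (N ℕ.+_) (sym (ℕ.+-identityʳ (β 1))))
               (applyUpTo-cong< r (λ i _ → cong suc (ℕ.+-assoc N (β 1) _))) ⟩
    + product (applyUpTo (λ i → suc (N ℕ.+ prefixSum β (suc i))) (suc r)) ∎

  drop-length : ∀ {A : Set} (xs : List A) → drop (length xs) xs ≡ []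
  drop-length []       = refl
  drop-length (x ∷ xs) = drop-length xs

  sum-drop : ∀ p (xs : List ℕ) → p ℕ.< length xs → sum (drop p xs) ≡ at xs (suc p) ℕ.+ sum (drop (suc p) xs)
  sum-drop zero    (x ∷ xs) _         = refl
  sum-drop (suc p) (x ∷ xs) (s≤s p<n) = sum-drop p xs p<n

  module _ (m : ℕ) (s : Vec ℕ (suc m)) where

    private
      xs : List ℕ
      xs = toList s

    -- α k = s_{n-k+1}: the entries of s read from the right
    α : ℕ → ℕ
    α k = at xs (suc m ∸ k ℕ.+ 1)

    sum1≡prefixSumProduct : sum1 m s ≡ prefixSumProduct 0 α m
    sum1≡prefixSumProduct = trans (indexSet-sum≡weightedSum m (binomialFactors α))
                                  (weightedSum-binomialFactors m m α ℕ.≤-refl)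

    sum2-factors : ℕ → ℕ → ℤ
    sum2-factors (suc zero) x = multichoose (+ at xs (suc m) + + 1) x
    sum2-factors k          x = multichoose (+ at xs (suc m ∸ k ℕ.+ 1) - + 1) x

    multiFactor≡sum2-factors : ∀ j k → multiFactor m s j k ≡ sum2-factors k (at j k)
    multiFactor≡sum2-factors j zero          = refl
    multiFactor≡sum2-factors j (suc zero)    = refl
    multiFactor≡sum2-factors j (suc (suc k)) = refl

    sum2≡prefixSumProduct : sum2 m s ≡ prefixSumProduct 0 α m
    sum2≡prefixSumProduct = begin
      sum2 m s
        ≡⟨ cong sumℤ (List.map-cong (λ j → cong (_* weightProd m j)
             (cong prodℤ (List.map-cong (multiFactor≡sum2-factors j) (oneTo m)))) (indexSet m)) ⟩
      sumℤ (map (λ j → prodℤ (map (λ k → sum2-factors k (at j k)) (oneTo m)) * weightProd m j) (indexSet m))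
        ≡⟨ indexSet-sum≡weightedSum m sum2-factors ⟩
      weightedSum m sum2-factors 0 m
        ≡⟨ weightedSum-multichooseFactors m m α sum2-factors ℕ.≤-refl first
             (λ k x → multichoose-ℕ-1 (α (suc (suc k))) x) ⟩
      prefixSumProduct 0 α m ∎
      where
      first : ∀ x → sum2-factors 1 x ≡ multichooseℤ (suc (α 1)) x
      first x = trans (multichoose-ℕ+1 (at xs (suc m)) x)
                      (cong (λ i → multichooseℤ (suc (at xs i)) x) (ℕ.+-comm 1 m))

    sum-drop≡prefixSum : ∀ i → i ℕ.≤ m → sum (drop (suc m ∸ i) xs) ≡ prefixSum α i
    sum-drop≡prefixSum zero    _   =
      cong sum (trans (cong (λ k → drop k xs) (sym (length-toList s))) (drop-length xs))
    sum-drop≡prefixSum (suc i) i<m = begin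
      sum (drop (m ∸ i) xs)
        ≡⟨ sum-drop (m ∸ i) xs (subst ((m ∸ i) ℕ.<_) (sym (length-toList s)) (s≤s (ℕ.m∸n≤m m i))) ⟩
      at xs (suc (m ∸ i)) ℕ.+ sum (drop (suc (m ∸ i)) xs)
        ≡⟨ cong₂ (λ y z → at xs y ℕ.+ sum (drop z xs)) (ℕ.+-comm 1 (m ∸ i)) (sym (ℕ.+-∸-assoc 1 i≤m)) ⟩
      α (suc i) ℕ.+ sum (drop (suc m ∸ i) xs)
        ≡⟨ cong (α (suc i) ℕ.+_) (sum-drop≡prefixSum i i≤m) ⟩
      α (suc i) ℕ.+ prefixSum α i
        ≡⟨ trans (ℕ.+-comm (α (suc i)) (prefixSum α i)) (sym (prefixSum-suc α i)) ⟩
      prefixSum α (suc i) ∎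
      where
      i≤m = ℕ.<⇒≤ i<m

    lhs≡prefixSumProduct : + lhs m s ≡ prefixSumProduct 0 α m
    lhs≡prefixSumProduct = begin
      + product (map (λ i → suc (sum (drop (suc m ∸ i) xs))) (oneTo m))
        ≡⟨ cong (+_ ∘ product) (map-oneTo _ m) ⟩
      + product (applyUpTo (λ i → suc (sum (drop (m ∸ i) xs))) m)
        ≡⟨ cong (+_ ∘ product) (applyUpTo-cong< m (λ i i<m → cong suc (sum-drop≡prefixSum (suc i) i<m))) ⟩
      + product (applyUpTo (λ i → suc (prefixSum α (suc i))) m)
        ≡⟨ sym (prefixSumProduct≡product 0 α m) ⟩
      prefixSumProduct 0 α m ∎

module DecreasingTrees where

  open import Data.Nat as ℕ using (ℕ; zero; suc)
  import Data.Nat.Properties as ℕ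
  open import Data.Nat.ListAction using (sum)
  open import Data.Fin using (Fin)
  open import Data.Fin.Base using (_<_; _≤_)
  open import Data.List using (List; []; _∷_; map; _++_; concatMap; length; replicate)
  import Data.List.Properties as List
  open import Data.List.Membership.Propositional using (_∈_; _∉_; find; lose)
  open import Data.List.Membership.Propositional.Properties
    using (∈-concatMap⁻; ∈-concatMap⁺; ∈-map⁻; ∈-map⁺; ∈-++⁻; ∈-++⁺ˡ; ∈-++⁺ʳ)
  open import Data.List.Relation.Unary.Any using (here; there)
  open import Data.List.Relation.Unary.All as All using (All; []; _∷_)
  import Data.List.Relation.Unary.All.Properties as All
  open import Data.List.Relation.Unary.AllPairs using (AllPairs; []; _∷_)
  open import Data.List.Relation.Unary.Unique.Propositional using (Unique)
  import Data.List.Relation.Unary.Unique.Propositional.Properties as Unique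
  open import Data.List.Relation.Binary.Disjoint.Propositional using (Disjoint)
  open import Data.List.Relation.Binary.Permutation.Propositional using (_↭_; ↭-sym; ↭-trans; ↭-refl; ↭-reflexive; prep; swap)
  import Data.List.Relation.Binary.Permutation.Propositional.Properties as ↭
  open import Data.Vec using (Vec; lookup)
  open import Data.Product using (_×_; _,_; proj₂; ∃)
  open import Data.Sum using (inj₁; inj₂)
  open import Data.Unit using (tt)
  open import Data.Empty using (⊥-elim)
  open import Function using (_∘_)
  open import Relation.Binary.PropositionalEquality
  open import Defs

  concatMap-unique : ∀ {A B : Set} (f : A → List B) {xs : List A} → Unique xs → (∀ x → Unique (f x)) →
    (∀ {x y} → x ∈ xs → y ∈ xs → x ≢ y → Disjoint (f x) (f y)) → Unique (concatMap f xs)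
  concatMap-unique f {[]}     _            _   _        = []
  concatMap-unique f {x ∷ xs} (x∉xs ∷ xs!) f-! disjoint =
    Unique.++⁺ (f-! x) (concatMap-unique f xs! f-! (λ x∈ y∈ → disjoint (there x∈) (there y∈))) fx#rest
    where
    fx#rest : Disjoint (f x) (concatMap f xs)
    fx#rest (v∈fx , v∈rest) with find (∈-concatMap⁻ f {xs = xs} v∈rest)
    ... | y , y∈xs , v∈fy = disjoint (here refl) (there y∈xs) (All.lookup x∉xs y∈xs) (v∈fx , v∈fy)

  length-concatMap : ∀ {A B : Set} (f : A → List B) (xs : List A) c → (∀ x → x ∈ xs → length (f x) ≡ c) →
                     length (concatMap f xs) ≡ length xs ℕ.* c
  length-concatMap f []       c _     = refl
  length-concatMap f (x ∷ xs) c |f|≡c = trans (List.length-++ (f x))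
    (cong₂ ℕ._+_ (|f|≡c x (here refl)) (length-concatMap f xs c (λ y → |f|≡c y ∘ there)))

  module _ {n : ℕ} (s : Vec ℕ n) where

    corolla : Fin n → Tree n
    corolla i = node i (replicate (suc (lookup s i)) leaf)

    mutual
      data Graft (i : Fin n) : Tree n → Tree n → Set where
        graft-leaf : Graft i leaf (corolla i)
        graft-node : ∀ {j ts ts′} → GraftL i ts ts′ → Graft i (node j ts) (node j ts′)

      data GraftL (i : Fin n) : List (Tree n) → List (Tree n) → Set where
        graft-here  : ∀ {t t′ ts} → Graft i t t′ → GraftL i (t ∷ ts) (t′ ∷ ts)
        graft-there : ∀ {t ts ts′} → GraftL i ts ts′ → GraftL i (t ∷ ts) (t ∷ ts′)

    mutual
      graftings : Fin n → Tree n → List (Tree n)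
      graftings i leaf        = corolla i ∷ []
      graftings i (node j ts) = map (node j) (graftingsL i ts)

      graftingsL : Fin n → List (Tree n) → List (List (Tree n))
      graftingsL i []       = []
      graftingsL i (t ∷ ts) = map (_∷ ts) (graftings i t) ++ map (t ∷_) (graftingsL i ts)

    mutual
      graftings-sound : ∀ i T {T′} → T′ ∈ graftings i T → Graft i T T′
      graftings-sound i leaf        (here refl) = graft-leaf
      graftings-sound i (node j ts) T′∈ with ∈-map⁻ (node j) T′∈
      ... | ts′ , ts′∈ , refl = graft-node (graftingsL-sound i ts ts′∈)

      graftingsL-sound : ∀ i ts {ts′} → ts′ ∈ graftingsL i ts → GraftL i ts ts′
      graftingsL-sound i (t ∷ ts) ts′∈ with ∈-++⁻ (map (_∷ ts) (graftings i t)) ts′∈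
      ... | inj₁ ∈here with ∈-map⁻ (_∷ ts) ∈here
      ...   | t′ , t′∈ , refl = graft-here (graftings-sound i t t′∈)
      graftingsL-sound i (t ∷ ts) ts′∈ | inj₂ ∈there with ∈-map⁻ (t ∷_) ∈there
      ...   | ts″ , ts″∈ , refl = graft-there (graftingsL-sound i ts ts″∈)

    mutual
      graftings-complete : ∀ {i T T′} → Graft i T T′ → T′ ∈ graftings i T
      graftings-complete graft-leaf               = here refl
      graftings-complete (graft-node {j = j} g)   = ∈-map⁺ (node j) (graftingsL-complete g)

      graftingsL-complete : ∀ {i ts ts′} → GraftL i ts ts′ → ts′ ∈ graftingsL i ts
      graftingsL-complete (graft-here {ts = ts} g)            = ∈-++⁺ˡ (∈-map⁺ (_∷ ts) (graftings-complete g))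
      graftingsL-complete {i} (graft-there {t = t} {ts} g) =
        ∈-++⁺ʳ (map (_∷ ts) (graftings i t)) (∈-map⁺ (t ∷_) (graftingsL-complete g))

    labelsL-leaves : ∀ k → labelsL {n} (replicate k leaf) ≡ []
    labelsL-leaves zero    = refl
    labelsL-leaves (suc k) = labelsL-leaves k

    mutual
      graft-labels : ∀ {i T T′} → Graft i T T′ → labels T′ ↭ i ∷ labels T
      graft-labels {i} graft-leaf = ↭-reflexive (cong (i ∷_) (labelsL-leaves (suc (lookup s i))))
      graft-labels {i} (graft-node {j = j} g) = ↭-trans (prep j (graftL-labels g)) (swap j i ↭-refl)

      graftL-labels : ∀ {i ts ts′} → GraftL i ts ts′ → labelsL ts′ ↭ i ∷ labelsL ts
      graftL-labels (graft-here {ts = ts} g)         = ↭.++⁺ʳ (labelsL ts) (graft-labels g)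
      graftL-labels {i} (graft-there {t = t} {ts} g) =
        ↭-trans (↭.++⁺ˡ (labels t) (graftL-labels g)) (↭.shift i (labels t) (labelsL ts))

    graft-≢ : ∀ {i T T′} → Graft i T T′ → T ≢ T′
    graft-≢ g refl = ℕ.1+n≢n (sym (↭.↭-length (graft-labels g)))

    mutual
      graftings-unique : ∀ i T → Unique (graftings i T)
      graftings-unique i leaf        = [] ∷ []
      graftings-unique i (node j ts) = Unique.map⁺ (λ { refl → refl }) (graftingsL-unique i ts)

      graftingsL-unique : ∀ i ts → Unique (graftingsL i ts)
      graftingsL-unique i []       = []
      graftingsL-unique i (t ∷ ts) = Unique.++⁺ (Unique.map⁺ (λ { refl → refl }) (graftings-unique i t))
                                                (Unique.map⁺ (λ { refl → refl }) (graftingsL-unique i ts)) disjoint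
        where
        disjoint : Disjoint (map (_∷ ts) (graftings i t)) (map (t ∷_) (graftingsL i ts))
        disjoint (∈here , ∈there) with ∈-map⁻ (_∷ ts) ∈here | ∈-map⁻ (t ∷_) ∈there
        ... | t′ , t′∈ , refl | _ , _ , t′∷ts≡t∷_ =
          graft-≢ (graftings-sound i t t′∈) (sym (cong head t′∷ts≡t∷_))
          where
          head : List (Tree n) → Tree n
          head []      = t
          head (x ∷ _) = x

    ∈-graft : ∀ {i T T′} → Graft i T T′ → i ∈ labels T′
    ∈-graft g = ↭.∈-resp-↭ (↭-sym (graft-labels g)) (here refl)

    mutual
      graft-injective : ∀ {i T₁ T₂ T′} → Graft i T₁ T′ → Graft i T₂ T′ →
                        i ∉ labels T₁ → i ∉ labels T₂ → T₁ ≡ T₂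
      graft-injective graft-leaf     graft-leaf     _  _  = refl
      graft-injective graft-leaf     (graft-node _) _  i∉ = ⊥-elim (i∉ (here refl))
      graft-injective (graft-node _) graft-leaf     i∉ _  = ⊥-elim (i∉ (here refl))
      graft-injective (graft-node {j = j} g₁) (graft-node g₂) i∉₁ i∉₂ =
        cong (node j) (graftL-injective g₁ g₂ (i∉₁ ∘ there) (i∉₂ ∘ there))

      graftL-injective : ∀ {i ts₁ ts₂ ts′} → GraftL i ts₁ ts′ → GraftL i ts₂ ts′ →
                         i ∉ labelsL ts₁ → i ∉ labelsL ts₂ → ts₁ ≡ ts₂
      graftL-injective (graft-here {ts = ts} g₁) (graft-here g₂) i∉₁ i∉₂ =
        cong (_∷ ts) (graft-injective g₁ g₂ (i∉₁ ∘ ∈-++⁺ˡ) (i∉₂ ∘ ∈-++⁺ˡ))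
      graftL-injective (graft-here g₁)  (graft-there _) _   i∉₂ = ⊥-elim (i∉₂ (∈-++⁺ˡ (∈-graft g₁)))
      graftL-injective (graft-there _)  (graft-here g₂) i∉₁ _   = ⊥-elim (i∉₁ (∈-++⁺ˡ (∈-graft g₂)))
      graftL-injective (graft-there {t = t} g₁) (graft-there g₂) i∉₁ i∉₂ =
        cong (t ∷_) (graftL-injective g₁ g₂ (i∉₁ ∘ ∈-++⁺ʳ (labels t)) (i∉₂ ∘ ∈-++⁺ʳ (labels t)))

    graftL-length : ∀ {i ts ts′} → GraftL i ts ts′ → length ts′ ≡ length ts
    graftL-length (graft-here _)  = refl
    graftL-length (graft-there g) = cong suc (graftL-length g)

    leaves-locallyOK : ∀ k → LocallyOKL s (replicate k leaf)
    leaves-locallyOK zero    = tt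
    leaves-locallyOK (suc k) = tt , leaves-locallyOK k

    corolla-locallyOK : ∀ i → LocallyOK s (corolla i)
    corolla-locallyOK i = List.length-replicate (suc (lookup s i)) ,
                          subst (All (_< i)) (sym (labelsL-leaves (suc (lookup s i)))) [] ,
                          leaves-locallyOK (suc (lookup s i))

    mutual
      graft-locallyOK : ∀ {i T T′} → Graft i T T′ → LocallyOK s T → All (i <_) (labels T) → LocallyOK s T′
      graft-locallyOK {i} graft-leaf _ _ = corolla-locallyOK i
      graft-locallyOK (graft-node g) (len≡ , below , ok) (i<j ∷ i<) =
        trans (graftL-length g) len≡ , ↭.All-resp-↭ (↭-sym (graftL-labels g)) (i<j ∷ below) , graftL-locallyOK g ok i<

      graftL-locallyOK : ∀ {i ts ts′} → GraftL i ts ts′ → LocallyOKL s ts → All (i <_) (labelsL ts) → LocallyOKL s ts′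
      graftL-locallyOK (graft-here {t = t} g) (ok , oks) i< = graft-locallyOK g ok (All.++⁻ˡ (labels t) i<) , oks
      graftL-locallyOK (graft-there {t = t} g) (ok , oks) i< = ok , graftL-locallyOK g oks (All.++⁻ʳ (labels t) i<)

    mutual
      graft-locallyOK⁻ : ∀ {i T T′} → Graft i T T′ → LocallyOK s T′ → LocallyOK s T
      graft-locallyOK⁻ graft-leaf _ = tt
      graft-locallyOK⁻ (graft-node g) (len≡ , below , ok) with ↭.All-resp-↭ (graftL-labels g) below
      ... | _ ∷ below′ = trans (sym (graftL-length g)) len≡ , below′ , graftL-locallyOK⁻ g ok

      graftL-locallyOK⁻ : ∀ {i ts ts′} → GraftL i ts ts′ → LocallyOKL s ts′ → LocallyOKL s ts
      graftL-locallyOK⁻ (graft-here g)  (ok , oks) = graft-locallyOK⁻ g ok , oks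
      graftL-locallyOK⁻ (graft-there g) (ok , oks) = ok , graftL-locallyOK⁻ g oks

    unlabelled⇒leaves : ∀ ts → labelsL {n} ts ≡ [] → ts ≡ replicate (length ts) leaf
    unlabelled⇒leaves []              _  = refl
    unlabelled⇒leaves (leaf ∷ ts)     ≡[] = cong (leaf ∷_) (unlabelled⇒leaves ts ≡[])
    unlabelled⇒leaves (node _ _ ∷ _)  ()

    below-and-above⇒[] : ∀ {i : Fin n} (l : List (Fin n)) → All (_< i) l → All (i ≤_) l → l ≡ []
    below-and-above⇒[] []      _         _         = refl
    below-and-above⇒[] (x ∷ l) (x<i ∷ _) (i≤x ∷ _) = ⊥-elim (ℕ.<-irrefl refl (ℕ.<-≤-trans x<i i≤x))

    -- a minimal label sits at a node whose children are all leaves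
    mutual
      prune : ∀ i T → LocallyOK s T → i ∈ labels T → All (i ≤_) (labels T) → ∃ λ T₀ → Graft i T₀ T
      prune i (node .i ts) (len≡ , below , _) (here refl) (_ ∷ i≤) =
        leaf , subst (Graft i leaf) (cong (node i) (sym children≡leaves)) graft-leaf
        where
        children≡leaves : ts ≡ replicate (suc (lookup s i)) leaf
        children≡leaves = trans (unlabelled⇒leaves ts (below-and-above⇒[] (labelsL ts) below i≤))
                                (cong (λ k → replicate k leaf) len≡)
      prune i (node j ts) (_ , _ , ok) (there i∈) (_ ∷ i≤) with pruneL i ts ok i∈ i≤
      ... | ts₀ , g = node j ts₀ , graft-node g

      pruneL : ∀ i ts → LocallyOKL s ts → i ∈ labelsL ts → All (i ≤_) (labelsL ts) → ∃ λ ts₀ → GraftL i ts₀ ts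
      pruneL i (t ∷ ts) (ok , oks) i∈ i≤ with ∈-++⁻ (labels t) i∈
      ... | inj₁ i∈t with prune i t ok i∈t (All.++⁻ˡ (labels t) i≤)
      ...   | t₀ , g = t₀ ∷ ts , graft-here g
      pruneL i (t ∷ ts) (ok , oks) i∈ i≤ | inj₂ i∈ts with pruneL i ts oks i∈ts (All.++⁻ʳ (labels t) i≤)
      ...   | ts₀ , g = t ∷ ts₀ , graft-there g

    trees : List (Fin n) → List (Tree n)
    trees []       = leaf ∷ []
    trees (i ∷ ls) = concatMap (graftings i) (trees ls)

    WithLabels : List (Fin n) → Tree n → Set
    WithLabels ls T = LocallyOK s T × (labels T ↭ ls)

    trees-sound : ∀ {ls} → AllPairs _<_ ls → ∀ T → T ∈ trees ls → WithLabels ls T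
    trees-sound {[]}     _           .leaf (here refl) = tt , ↭-refl
    trees-sound {i ∷ ls} (i< ∷ ls<) T  T∈ with find (∈-concatMap⁻ (graftings i) {xs = trees ls} T∈)
    ... | T₀ , T₀∈ , T∈g with trees-sound ls< T₀ T₀∈ | graftings-sound i T₀ T∈g
    ...   | ok , T₀↭ls | g =
      graft-locallyOK g ok (↭.All-resp-↭ (↭-sym T₀↭ls) i<) , ↭-trans (graft-labels g) (prep i T₀↭ls)

    trees-complete : ∀ {ls} → AllPairs _<_ ls → ∀ T → WithLabels ls T → T ∈ trees ls
    trees-complete {[]}     _ leaf         _        = here refl
    trees-complete {[]}     _ (node _ _)   (_ , T↭) with ↭.↭-length T↭
    ... | ()
    trees-complete {i ∷ ls} (i< ∷ ls<) T (ok , T↭)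
      with prune i T ok (↭.∈-resp-↭ (↭-sym T↭) (here refl))
                        (↭.All-resp-↭ (↭-sym T↭) (ℕ.≤-refl ∷ All.map ℕ.<⇒≤ i<))
    ... | T₀ , g = ∈-concatMap⁺ (graftings i) {xs = trees ls} (lose T₀∈ (graftings-complete g))
      where
      T₀∈ : T₀ ∈ trees ls
      T₀∈ = trees-complete ls< T₀ (graft-locallyOK⁻ g ok , ↭.drop-∷ (↭-trans (↭-sym (graft-labels g)) T↭))

    trees-unique : ∀ {ls} → AllPairs _<_ ls → Unique (trees ls)
    trees-unique {[]}     _          = [] ∷ []
    trees-unique {i ∷ ls} (i< ∷ ls<) = concatMap-unique (graftings i) (trees-unique ls<) (graftings-unique i)
      λ T₁∈ T₂∈ T₁≢T₂ (T′∈₁ , T′∈₂) →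
        T₁≢T₂ (graft-injective (graftings-sound i _ T′∈₁) (graftings-sound i _ T′∈₂) (i∉ T₁∈) (i∉ T₂∈))
      where
      i∉ : ∀ {T} → T ∈ trees ls → i ∉ labels T
      i∉ T∈ i∈ = ℕ.<-irrefl refl (All.lookup i< (↭.∈-resp-↭ (proj₂ (trees-sound ls< _ T∈)) i∈))

    mutual
      leaves : Tree n → ℕ
      leaves leaf        = 1
      leaves (node _ ts) = leavesL ts

      leavesL : List (Tree n) → ℕ
      leavesL []       = 0
      leavesL (t ∷ ts) = leaves t ℕ.+ leavesL ts

    mutual
      graftings-length : ∀ i T → length (graftings i T) ≡ leaves T
      graftings-length i leaf        = refl
      graftings-length i (node j ts) = trans (List.length-map (node j) (graftingsL i ts)) (graftingsL-length i ts)

      graftingsL-length : ∀ i ts → length (graftingsL i ts) ≡ leavesL ts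
      graftingsL-length i []       = refl
      graftingsL-length i (t ∷ ts) = trans (List.length-++ (map (_∷ ts) (graftings i t)))
        (cong₂ ℕ._+_ (trans (List.length-map (_∷ ts) (graftings i t)) (graftings-length i t))
                     (trans (List.length-map (t ∷_) (graftingsL i ts)) (graftingsL-length i ts)))

    leavesL-leaves : ∀ k → leavesL (replicate k leaf) ≡ k
    leavesL-leaves zero    = refl
    leavesL-leaves (suc k) = cong suc (leavesL-leaves k)

    mutual
      graft-leaves : ∀ {i T T′} → Graft i T T′ → leaves T′ ≡ leaves T ℕ.+ lookup s i
      graft-leaves {i} graft-leaf  = leavesL-leaves (suc (lookup s i))
      graft-leaves (graft-node g) = graftL-leaves g

      graftL-leaves : ∀ {i ts ts′} → GraftL i ts ts′ → leavesL ts′ ≡ leavesL ts ℕ.+ lookup s i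
      graftL-leaves {i} (graft-here {t = t} {ts = ts} g) = trans (cong (ℕ._+ leavesL ts) (graft-leaves g))
        (trans (ℕ.+-assoc (leaves t) (lookup s i) _) (trans (cong (leaves t ℕ.+_) (ℕ.+-comm (lookup s i) _))
               (sym (ℕ.+-assoc (leaves t) _ _))))
      graftL-leaves {i} (graft-there {t = t} g) =
        trans (cong (leaves t ℕ.+_) (graftL-leaves g)) (sym (ℕ.+-assoc (leaves t) _ _))

    trees-leaves : ∀ ls T → T ∈ trees ls → leaves T ≡ suc (sum (map (lookup s) ls))
    trees-leaves []       .leaf (here refl) = refl
    trees-leaves (i ∷ ls) T     T∈ with find (∈-concatMap⁻ (graftings i) {xs = trees ls} T∈)
    ... | T₀ , T₀∈ , T∈g = trans (graft-leaves (graftings-sound i T₀ T∈g))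
      (trans (cong (ℕ._+ lookup s i) (trees-leaves ls T₀ T₀∈)) (cong suc (ℕ.+-comm _ (lookup s i))))

    trees-length : ∀ i ls → length (trees (i ∷ ls)) ≡ length (trees ls) ℕ.* suc (sum (map (lookup s) ls))
    trees-length i ls = length-concatMap (graftings i) (trees ls) _
                          (λ T T∈ → trans (graftings-length i T) (trees-leaves ls T T∈))

module Counting where

  open import Data.Nat as ℕ using (ℕ; zero; suc; _∸_; z≤n; s≤s)
  import Data.Nat.Properties as ℕ
  open import Data.Nat.ListAction using (sum; product)
  open import Data.Nat.ListAction.Properties using (product-++)
  open import Data.List using (List; []; _∷_; map; _++_; length; drop; applyUpTo; allFin; tabulate; [_])
  import Data.List.Properties as List
  open import Data.Vec as Vec using (Vec; lookup; toList)
  open import Data.Vec.Properties using (length-toList)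
  open import Data.Product using (_,_; ∃)
  open import Function using (_∘_)
  open import Relation.Binary.PropositionalEquality hiding ([_])
  open import Defs using (lhs)
  open IndexSet using (map-oneTo)
  open Evaluation using (drop-length)
  open DecreasingTrees
  open ≡-Reasoning

  drop-∷ : ∀ {A : Set} k (xs : List A) → k ℕ.< length xs → ∃ λ y → drop k xs ≡ y ∷ drop (suc k) xs
  drop-∷ zero    (y ∷ xs) _         = y , refl
  drop-∷ (suc k) (y ∷ xs) (s≤s k<n) = drop-∷ k xs k<n

  tabulate-lookup : ∀ {A : Set} {k} (v : Vec A k) → tabulate (lookup v) ≡ toList v
  tabulate-lookup Vec.[]      = refl
  tabulate-lookup (x Vec.∷ v) = cong (x ∷_) (tabulate-lookup v)

  length-allFin : ∀ n → length (allFin n) ≡ n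
  length-allFin n = List.length-tabulate (λ x → x)

  map-lookup-allFin : ∀ {A : Set} {k} (v : Vec A k) → map (lookup v) (allFin k) ≡ toList v
  map-lookup-allFin v = trans (List.map-tabulate (λ x → x) (lookup v)) (tabulate-lookup v)

  module _ (m : ℕ) (s : Vec ℕ (suc m)) where

    private
      n = suc m
      xs = toList s

    count : ℕ → ℕ
    count k = length (trees s (drop k (allFin n)))

    count-suc : ∀ k → k ℕ.< n → count k ≡ count (suc k) ℕ.* suc (sum (drop (suc k) xs))
    count-suc k k<n with drop-∷ k (allFin n) (subst (k ℕ.<_) (sym (length-allFin n)) k<n)
    ... | i , drop≡ = trans (cong (length ∘ trees s) drop≡) (trans (trees-length s i (drop (suc k) (allFin n)))
        (cong (λ l → count (suc k) ℕ.* suc (sum l))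
              (trans (sym (List.drop-map (suc k) (allFin n))) (cong (drop (suc k)) (map-lookup-allFin s)))))

    factor : ℕ → ℕ
    factor i = suc (sum (drop (n ∸ i) xs))

    count-down : ∀ j → j ℕ.≤ n → count (n ∸ j) ≡ product (applyUpTo factor j)
    count-down zero    _   = cong (length ∘ trees s)
      (trans (cong (λ k → drop k (allFin n)) (sym (length-allFin n))) (drop-length (allFin n)))
    count-down (suc j) j<n = begin
      count (n ∸ suc j)
        ≡⟨ count-suc (n ∸ suc j) (ℕ.∸-monoʳ-< {n} {suc j} {0} (s≤s z≤n) j<n) ⟩
      count (suc (n ∸ suc j)) ℕ.* suc (sum (drop (suc (n ∸ suc j)) xs))
        ≡⟨ cong (λ k → count k ℕ.* suc (sum (drop k xs))) (sym (ℕ.+-∸-assoc 1 j<n)) ⟩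
      count (n ∸ j) ℕ.* factor j
        ≡⟨ cong (ℕ._* factor j) (count-down j (ℕ.<⇒≤ j<n)) ⟩
      product (applyUpTo factor j) ℕ.* factor j
        ≡⟨ cong (product (applyUpTo factor j) ℕ.*_) (sym (ℕ.*-identityʳ (factor j))) ⟩
      product (applyUpTo factor j) ℕ.* product [ factor j ]
        ≡⟨ sym (product-++ (applyUpTo factor j) [ factor j ]) ⟩
      product (applyUpTo factor j ++ [ factor j ])
        ≡⟨ cong product (List.applyUpTo-∷ʳ factor j) ⟩
      product (applyUpTo factor (suc j)) ∎

    trees-count : length (trees s (allFin n)) ≡ lhs m s
    trees-count = begin
      count 0
        ≡⟨ cong count (sym (ℕ.n∸n≡0 n)) ⟩
      count (n ∸ n)
        ≡⟨ count-down n ℕ.≤-refl ⟩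
      factor 0 ℕ.* product (applyUpTo (factor ∘ suc) m)
        ≡⟨ cong (λ l → suc (sum l) ℕ.* product (applyUpTo (factor ∘ suc) m))
                (trans (cong (λ k → drop k xs) (sym (length-toList s))) (drop-length xs)) ⟩
      1 ℕ.* product (applyUpTo (factor ∘ suc) m)
        ≡⟨ ℕ.*-identityˡ _ ⟩
      product (applyUpTo (factor ∘ suc) m)
        ≡⟨ cong product (sym (map-oneTo (λ i → suc (sum (drop (n ∸ i) xs))) m)) ⟩
      lhs m s ∎

open import Defs
open import Data.Nat using (ℕ; suc)
open import Data.Integer using (+_)
open import Data.Vec using (Vec)
open import Data.List using (List; length; allFin)
open import Data.List.Membership.Propositional using (_∈_)
open import Data.List.Relation.Unary.Unique.Propositional using (Unique)
open import Data.List.Relation.Unary.AllPairs using (AllPairs)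
open import Data.List.Relation.Unary.AllPairs.Properties using (tabulate⁺-<)
open import Data.Fin.Base using (_<_)
open import Data.Product using (_×_; ∃; _,_)
open import Relation.Binary.PropositionalEquality using (_≡_; trans; sym)
open Evaluation using (lhs≡prefixSumProduct; sum1≡prefixSumProduct; sum2≡prefixSumProduct)
open DecreasingTrees using (trees; trees-sound; trees-complete; trees-unique)
open Counting using (trees-count)

corollary6p40 : (m : ℕ) (s : Vec ℕ (suc m)) →
    (+ lhs m s ≡ sum1 m s) × (sum1 m s ≡ sum2 m s) ×
    ∃ (λ (ts : List (Tree (suc m))) →
      Unique ts ×
      ((T : Tree (suc m)) → (T ∈ ts → IsSDecreasing s T) × (IsSDecreasing s T → T ∈ ts)) ×
      length ts ≡ lhs m s)
corollary6p40 m s =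
  trans (lhs≡prefixSumProduct m s) (sym (sum1≡prefixSumProduct m s)) ,
  trans (sum1≡prefixSumProduct m s) (sym (sum2≡prefixSumProduct m s)) ,
  trees s (allFin (suc m)) ,
  trees-unique s labels-increasing ,
  (λ T → trees-sound s labels-increasing T , trees-complete s labels-increasing T) ,
  trees-count m s
  where
  labels-increasing : AllPairs _<_ (allFin (suc m))
  labels-increasing = tabulate⁺-< (λ i<j → i<j)
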